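{- Let $k \ge 3$ and let $G$ be a $(k+1)$-critical graph with minimum degree $\delta(G)=k$. Then there exists an injective map $f:\mathcal{C}_{\le k}(K_{k+1}) \to \mathcal{C}(G)$ such that for every $C\in \mathcal{C}_{\le k}(K_{k+1})$, $|V(f(C))| \equiv 0 \pmod{|V(C)|}$.
   Context: A graph is $(k+1)$-critical if its chromatic number is $k+1$ but every proper subgraph has chromatic number at most $k$. For a graph $H$, $\mathcal{C}(H)$ denotes the set of all cycles (as subgraphs) of $H$, and $\mathcal{C}_{\le i}(H)$ the set of cycles of $H$ of length at most $i$. $K_{k+1}$ is the complete graph on $k+1$ vertices. -}

module Defs where

open import Data.Nat using (ℕ; zero; suc; _+_; _≤_)
open import Data.Nat.DivMod using (_mod_)
open import Data.Fin using (Fin; toℕ; _≟_)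
open import Data.Bool using (Bool; true; false; if_then_else_; not)
open import Data.List using (List; map; allFin)
open import Data.Nat.ListAction using (sum)
open import Data.Product using (Σ; ∃; _×_; _,_)
open import Data.Sum using (_⊎_)
open import Relation.Nullary using (¬_)
open import Relation.Nullary.Decidable using (⌊_⌋)
open import Relation.Binary.PropositionalEquality using (_≡_; _≢_)
open import Function using (_⇔_)
open import Function.Definitions using (Injective)

record Graph : Set where
  field
    n     : ℕ
    Adj   : Fin n → Fin n → Bool
    adj-sym : ∀ u v → Adj u v ≡ Adj v u
    adj-irr : ∀ v → Adj v v ≡ false
open Graph public

K : ℕ → Graph
K m = record { n = m ; Adj = λ u v → not ⌊ u ≟ v ⌋ ; adj-sym = symK ; adj-irr = irrK }
  where
  open import Relation.Binary.PropositionalEquality using (refl; sym)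
  open import Relation.Nullary using (yes; no)
  symK : ∀ (u v : Fin m) → not ⌊ u ≟ v ⌋ ≡ not ⌊ v ≟ u ⌋
  symK u v with u ≟ v | v ≟ u
  ... | yes _ | yes _ = refl
  ... | no _  | no _  = refl
  ... | yes p | no q  = Data.Empty.⊥-elim (q (sym p)) where import Data.Empty
  ... | no p  | yes q = Data.Empty.⊥-elim (p (sym q)) where import Data.Empty
  irrK : ∀ (v : Fin m) → not ⌊ v ≟ v ⌋ ≡ false
  irrK v with v ≟ v
  ... | yes _ = refl
  ... | no p  = Data.Empty.⊥-elim (p refl) where import Data.Empty

Colorable : Graph → ℕ → Set
Colorable G k = Σ (Fin (n G) → Fin k) λ c →
  ∀ u v → Adj G u v ≡ true → c u ≢ c v

HasChromaticNumber : Graph → ℕ → Set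
HasChromaticNumber G k = Colorable G k × (∀ j → Colorable G j → k ≤ j)

record Subgraph (G : Graph) : Set where
  field
    V∈ : Fin (n G) → Bool
    E∈ : Fin (n G) → Fin (n G) → Bool
    E-sym : ∀ u v → E∈ u v ≡ E∈ v u
    E-sub : ∀ u v → E∈ u v ≡ true →
            (Adj G u v ≡ true) × (V∈ u ≡ true) × (V∈ v ≡ true)
open Subgraph public

IsProper : {G : Graph} → Subgraph G → Set
IsProper {G} H = (∃ λ v → V∈ H v ≡ false)
               ⊎ (∃ λ u → ∃ λ v → Adj G u v ≡ true × E∈ H u v ≡ false)

-- χ(H) ≤ k, i.e. H admits a proper k-colouring (colours of vertices
-- outside H are irrelevant).
SubColorable : {G : Graph} → Subgraph G → ℕ → Set
SubColorable {G} H k = Σ (Fin (n G) → Fin k) λ c →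
  ∀ u v → E∈ H u v ≡ true → c u ≢ c v

Critical : ℕ → Graph → Set
Critical k G = HasChromaticNumber G (suc k)
             × (∀ (H : Subgraph G) → IsProper H → SubColorable H k)

deg : (G : Graph) → Fin (n G) → ℕ
deg G v = sum (map (λ u → if Adj G v u then 1 else 0) (allFin (n G)))

MinDegree : Graph → ℕ → Set
MinDegree G d = (∀ v → d ≤ deg G v) × (∃ λ v → deg G v ≡ d)

next : ∀ {l} → Fin (suc l) → Fin (suc l)
next {l} i = suc (toℕ i) mod (suc l)

-- A cycle of G presented by a cyclic sequence of m = suc l ≥ 3
-- distinct vertices w 0, ..., w l with consecutive (cyclically) adjacent.
record Cycle (G : Graph) : Set where
  field
    l     : ℕ
    l≥2   : 2 ≤ l
    w     : Fin (suc l) → Fin (n G)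
    w-inj : Injective _≡_ _≡_ w
    w-adj : ∀ i → Adj G (w i) (w (next i)) ≡ true
open Cycle public

len : {G : Graph} → Cycle G → ℕ
len C = suc (l C)

CEdge : {G : Graph} → Cycle G → Fin (n G) → Fin (n G) → Set
CEdge C a b = ∃ λ i → (a ≡ w C i × b ≡ w C (next i)) ⊎ (b ≡ w C i × a ≡ w C (next i))

-- Two presentations give the same cycle subgraph iff they have the same
-- edge set (a cycle's vertex set is determined by its edge set).
_≈C_ : {G : Graph} → Cycle G → Cycle G → Set
C ≈C D = ∀ a b → CEdge C a b ⇔ CEdge D a b

CycleLe : ℕ → Graph → Set
CycleLe i H = Σ (Cycle H) λ C → len C ≤ i

module Submission where

-- Fix v of degree k and a k-colouring φ of G - v; by criticality the k neighbours of v carry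
-- the k colours, one each (u a has colour a). Vertex 0 of K_{k+1} stands for v and vertex a + 1
-- for colour a. Given a cyclic sequence P of distinct colours, call x → y an arc of G - v if φ y
-- follows φ x in P. From every u (P s) there is an arc walk to every u (P t): otherwise, giving
-- each vertex coloured P i that has an arc walk to u (P t) the colour P (i - 1) keeps the
-- colouring proper and frees a colour around v, so G would be k-colourable (a Kempe-chain
-- argument). Closing such walks gives cycles whose colours run periodically through P, so
-- their length is a multiple of |P|. A cycle of K_{k+1} avoiding 0 is such a P; one through 0
-- is realised through v, with a colour it does not use in place of 0. The colours along the
-- image give back the cycle, hence injectivity, and tracing cycles of K_{k+1} from their edge
-- sets makes the map depend on cycles as subgraphs only.

open import Defs
open import Data.Nat using (ℕ; zero; suc; _+_; _*_; _∸_; _≤_; _<_; z≤n; s≤s; pred; _≤?_; >-nonZero)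
open import Data.Nat.Properties
open import Data.Nat.DivMod
open import Data.Nat.Divisibility using (_∣_; m%n≡0⇒n∣m; n∣m⇒m%n≡0; ∣⇒≤)
open import Data.Nat.Tactic.RingSolver using (solve-∀)
open import Data.Nat.ListAction using (sum)
open import Data.Fin using (Fin; toℕ; fromℕ<; punchIn; punchOut) renaming (zero to fzero; suc to fsuc)
import Data.Fin.Properties as FP
open import Data.Bool using (Bool; true; false; if_then_else_; not; _∧_; _∨_)
import Data.Bool.Properties as BP
open import Data.List using (List; []; _∷_; length)
import Data.List as List
import Data.List.Properties as ListP
open import Data.List.Membership.Propositional using (_∈_)
open import Data.List.Relation.Unary.Any using (here; there)
open import Data.List.Relation.Unary.All as All using (All)
open import Data.List.Relation.Unary.All.Properties using (¬Any⇒All¬)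
open import Data.List.Relation.Unary.Unique.Propositional using (Unique)
open import Data.List.Relation.Unary.AllPairs using ([]; _∷_)
open import Data.Vec using (Vec)
import Data.Vec as Vec
import Data.Vec.Properties as VecP
open import Data.Product using (Σ; _×_; _,_; proj₁; proj₂)
open import Data.Sum using (_⊎_; inj₁; inj₂)
open import Data.Empty using (⊥-elim)
open import Relation.Nullary using (¬_; Dec; does; yes; no; ¬?)
open import Relation.Nullary.Decidable using (_×-dec_; _⊎-dec_; _→-dec_; dec-true; dec-false; does-⇔)
open import Relation.Binary using (DecidableEquality; Tri; tri<; tri≈; tri>)
open import Relation.Binary.PropositionalEquality
open import Function using (_∘_; id; case_of_)
open import Function.Definitions using (Injective)
open import Function.Bundles using (_⇔_; mk⇔; Equivalence)

-- Walks and loop erasure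

module Walks {A : Set} (_≟_ : DecidableEquality A) where
  open import Data.List.Membership.DecPropositional _≟_ using (_∈?_)

  data Walk (R : A → A → Set) : A → A → List A → Set where
    done : ∀ {a} → Walk R a a (a ∷ [])
    step : ∀ {a c b ws} → R a c → Walk R c b ws → Walk R a b (a ∷ ws)

  nth : List A → ℕ → A → A
  nth []       i       d = d
  nth (x ∷ xs) zero    d = x
  nth (x ∷ xs) (suc i) d = nth xs i d

  nth-∈ : ∀ xs i d → i < length xs → nth xs i d ∈ xs
  nth-∈ (x ∷ xs) zero    d _       = here refl
  nth-∈ (x ∷ xs) (suc i) d (s≤s p) = there (nth-∈ xs i d p)

  nth-irrelevant : ∀ xs i d d′ → i < length xs → nth xs i d ≡ nth xs i d′
  nth-irrelevant (x ∷ xs) zero    d d′ _       = refl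
  nth-irrelevant (x ∷ xs) (suc i) d d′ (s≤s p) = nth-irrelevant xs i d d′ p

  nth-injective : ∀ {xs} → Unique xs → ∀ i j d → i < length xs → j < length xs →
                  nth xs i d ≡ nth xs j d → i ≡ j
  nth-injective (_ ∷ u) zero zero d _ _ e = refl
  nth-injective {_ ∷ xs} (x∉ ∷ u) zero (suc j) d _ (s≤s q) e = ⊥-elim (All.lookup x∉ (nth-∈ xs j d q) e)
  nth-injective {_ ∷ xs} (x∉ ∷ u) (suc i) zero d (s≤s p) _ e = ⊥-elim (All.lookup x∉ (nth-∈ xs i d p) (sym e))
  nth-injective (_ ∷ u) (suc i) (suc j) d (s≤s p) (s≤s q) e = cong suc (nth-injective u i j d p q e)

  module _ {R : A → A → Set} where

    walk-nonempty : ∀ {a b ws} → Walk R a b ws → 1 ≤ length ws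
    walk-nonempty done       = s≤s z≤n
    walk-nonempty (step _ _) = s≤s z≤n

    walk-head : ∀ {a b ws} d → Walk R a b ws → nth ws 0 d ≡ a
    walk-head d done       = refl
    walk-head d (step _ _) = refl

    walk-last : ∀ {a b ws} d → Walk R a b ws → nth ws (pred (length ws)) d ≡ b
    walk-last d done                = refl
    walk-last d (step r done)       = refl
    walk-last d (step r (step r′ w)) = walk-last d (step r′ w)

    walk-edge : ∀ {a b ws} d → Walk R a b ws → ∀ i → suc i < length ws →
                R (nth ws i d) (nth ws (suc i) d)
    walk-edge d done       i       (s≤s ())
    walk-edge d (step r w) zero    _       = subst (R _) (sym (walk-head d w)) r
    walk-edge d (step r w) (suc i) (s≤s p) = walk-edge d w i p

    walk-all : ∀ {a b ws} (Q : A → Set) → (∀ {x y} → R x y → Q x) → Q b →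
               Walk R a b ws → All Q ws
    walk-all Q f qb done       = qb All.∷ All.[]
    walk-all Q f qb (step r w) = f r All.∷ walk-all Q f qb w

    _++ʷ_ : ∀ {a b c ws vs} → Walk R a b ws → Walk R b c vs → Σ (List A) λ us → Walk R a c us
    done       ++ʷ w′ = _ , w′
    (step r w) ++ʷ w′ = _ , step r (proj₂ (w ++ʷ w′))

    firstEdge : ∀ {a b ws} → Walk R a b ws → a ≢ b →
                Σ A λ c → R a c × Σ (List A) λ ws′ → Walk R c b ws′
    firstEdge done       a≢b = ⊥-elim (a≢b refl)
    firstEdge (step r w) _   = _ , r , _ , w

    dropUntil : ∀ {c b ws} → Walk R c b ws → Unique ws → ∀ {a} → a ∈ ws →
                Σ (List A) λ ws′ → Walk R a b ws′ × Unique ws′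
    dropUntil done       u       (here refl) = _ , done , u
    dropUntil (step r w) u       (here refl) = _ , step r w , u
    dropUntil (step r w) (_ ∷ u) (there a∈)  = dropUntil w u a∈

    loopErase : ∀ {a b ws} → Walk R a b ws → Σ (List A) λ ws′ → Walk R a b ws′ × Unique ws′
    loopErase done = _ , done , (All.[] ∷ [])
    loopErase {a} (step r w) with loopErase w
    ... | ws′ , w′ , u′ with a ∈? ws′
    ...   | yes a∈ = dropUntil w′ u′ a∈
    ...   | no  a∉ = _ , step r w′ , (¬Any⇒All¬ ws′ a∉ ∷ u′)

-- Congruence modulo the length of a cycle

x*x+x≡x*[1+x] : ∀ x → x * x + x ≡ x * suc x
x*x+x≡x*[1+x] = solve-∀

module Congruence (l : ℕ) where
  m : ℕ
  m = suc l

  record _≋_ (a b : ℕ) : Set where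
    constructor mk
    field get : a % m ≡ b % m
  open _≋_ public

  infix 4 _≋_

  ≋-refl : ∀ {a} → a ≋ a
  ≋-refl = mk refl

  ≋-sym : ∀ {a b} → a ≋ b → b ≋ a
  ≋-sym (mk p) = mk (sym p)

  ≋-trans : ∀ {a b c} → a ≋ b → b ≋ c → a ≋ c
  ≋-trans (mk p) (mk q) = mk (trans p q)

  ≡⇒≋ : ∀ {a b} → a ≡ b → a ≋ b
  ≡⇒≋ refl = ≋-refl

  +-≋ : ∀ {a b c d} → a ≋ b → c ≋ d → a + c ≋ b + d
  +-≋ {a} {b} {c} {d} (mk p) (mk q) = mk (begin
    (a + c) % m         ≡⟨ %-distribˡ-+ a c m ⟩
    (a % m + c % m) % m ≡⟨ cong₂ (λ x y → (x + y) % m) p q ⟩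
    (b % m + d % m) % m ≡⟨ %-distribˡ-+ b d m ⟨
    (b + d) % m         ∎)
    where open ≡-Reasoning

  *-≋ : ∀ {a b c d} → a ≋ b → c ≋ d → a * c ≋ b * d
  *-≋ {a} {b} {c} {d} (mk p) (mk q) = mk (begin
    (a * c) % m             ≡⟨ %-distribˡ-* a c m ⟩
    (a % m * (c % m)) % m   ≡⟨ cong₂ (λ x y → (x * y) % m) p q ⟩
    (b % m * (d % m)) % m   ≡⟨ %-distribˡ-* b d m ⟨
    (b * d) % m             ∎)
    where open ≡-Reasoning

  module ≋-Reasoning where
    infix  1 begin_
    infixr 2 _≈⟨_⟩_
    infix  3 _∎

    begin_ : ∀ {x y} → x ≋ y → x ≋ y
    begin p = p

    _≈⟨_⟩_ : ∀ x {y z} → x ≋ y → y ≋ z → x ≋ z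
    x ≈⟨ p ⟩ q = ≋-trans p q

    _∎ : ∀ x → x ≋ x
    x ∎ = ≋-refl

  m≋0 : m ≋ 0
  m≋0 = mk (n%n≡0 m)

  l+1≋0 : l + 1 ≋ 0
  l+1≋0 = ≋-trans (≡⇒≋ (+-comm l 1)) m≋0

  %-≋ : ∀ a → a % m ≋ a
  %-≋ a = mk (m%n%n≡m%n a m)

  *m≋0 : ∀ c → c * m ≋ 0
  *m≋0 c = mk (m*n%n≡0 c m)

  +m≋ : ∀ a → a + m ≋ a
  +m≋ a = mk ([m+n]%n≡m%n a m)

  ≋⇒≡ : ∀ {a b} → a < m → b < m → a ≋ b → a ≡ b
  ≋⇒≡ p q (mk e) = trans (sym (m<n⇒m%n≡m p)) (trans e (m<n⇒m%n≡m q))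

  +-cancelʳ-≋ : ∀ {a b c} → a + c ≋ b + c → a ≋ b
  +-cancelʳ-≋ {a} {b} {c} e = ≋-trans (≋-sym (+c+lc≋ a)) (≋-trans (+-≋ e (≋-refl {l * c})) (+c+lc≋ b))
    where
    +c+lc≋ : ∀ x → x + c + l * c ≋ x
    +c+lc≋ x = mk (trans (cong (_% m) (trans (+-assoc x c (l * c)) (cong (x +_) (*-comm m c))))
                         ([m+kn]%n≡m%n x c m))

  +-cancelˡ-≋ : ∀ {a b c} → c + a ≋ c + b → a ≋ b
  +-cancelˡ-≋ {a} {b} {c} e = +-cancelʳ-≋ (≋-trans (≡⇒≋ (+-comm a c)) (≋-trans e (≡⇒≋ (+-comm c b))))

  l*l≋1 : l * l ≋ 1
  l*l≋1 = +-cancelʳ-≋ {c = l} (≋-trans (≡⇒≋ l*l+l≡l*m) (≋-trans (*m≋0 l) (≋-sym m≋0)))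
    where
    l*l+l≡l*m : l * l + l ≡ l * m
    l*l+l≡l*m = x*x+x≡x*[1+x] l

  -- `l` plays the role of -1 modulo m.
  l*-cancel-≋ : ∀ {a b} → l * a ≋ l * b → a ≋ b
  l*-cancel-≋ {a} {b} e = ≋-trans (≋-sym (l*l*≋ a)) (≋-trans (≡⇒≋ (*-assoc l l a))
                            (≋-trans (*-≋ (≋-refl {l}) e) (≋-trans (≡⇒≋ (sym (*-assoc l l b))) (l*l*≋ b))))
    where
    l*l*≋ : ∀ x → l * l * x ≋ x
    l*l*≋ x = ≋-trans (*-≋ l*l≋1 (≋-refl {x})) (≡⇒≋ (*-identityˡ x))

  toFin : ℕ → Fin m
  toFin a = a mod m

  toℕ-toFin : ∀ a → toℕ (toFin a) ≡ a % m
  toℕ-toFin a = FP.toℕ-fromℕ< (m%n<n a m)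

  toℕ-toFin-≋ : ∀ a → toℕ (toFin a) ≋ a
  toℕ-toFin-≋ a = ≋-trans (≡⇒≋ (toℕ-toFin a)) (%-≋ a)

  toFin-cong : ∀ {a b} → a ≋ b → toFin a ≡ toFin b
  toFin-cong {a} {b} (mk e) = FP.toℕ-injective (trans (toℕ-toFin a) (trans e (sym (toℕ-toFin b))))

  toFin-injective : ∀ {a b} → toFin a ≡ toFin b → a ≋ b
  toFin-injective {a} {b} e = mk (trans (sym (toℕ-toFin a)) (trans (cong toℕ e) (toℕ-toFin b)))

  toFin-toℕ : ∀ (i : Fin m) → toFin (toℕ i) ≡ i
  toFin-toℕ i = FP.toℕ-injective (trans (toℕ-toFin (toℕ i)) (m<n⇒m%n≡m (FP.toℕ<n i)))

  toℕ-toFin-small : ∀ {a} → a < m → toℕ (toFin a) ≡ a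
  toℕ-toFin-small {a} p = trans (toℕ-toFin a) (m<n⇒m%n≡m p)

  next≡toFin : ∀ (i : Fin m) → next i ≡ toFin (toℕ i + 1)
  next≡toFin i = cong toFin (+-comm 1 (toℕ i))

  toℕ-next≋ : ∀ (i : Fin m) → toℕ (next i) ≋ toℕ i + 1
  toℕ-next≋ i = ≋-trans (toℕ-toFin-≋ (suc (toℕ i))) (≡⇒≋ (+-comm 1 (toℕ i)))

  toℕ-next-< : ∀ (i : Fin m) → toℕ i < l → toℕ (next i) ≡ suc (toℕ i)
  toℕ-next-< i p = toℕ-toFin-small (s≤s p)

  next-last : ∀ (i : Fin m) → toℕ i ≡ l → next i ≡ fzero
  next-last i p = FP.toℕ-injective (trans (toℕ-toFin (suc (toℕ i))) (trans (cong (λ x → suc x % m) p) (n%n≡0 m)))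

  prev : Fin m → Fin m
  prev i = toFin (toℕ i + l)

  next-prev : ∀ i → next (prev i) ≡ i
  next-prev i = trans (next≡toFin (prev i)) (trans (toFin-cong i+l+1≋i) (toFin-toℕ i))
    where
    i+l+1≋i : toℕ (prev i) + 1 ≋ toℕ i
    i+l+1≋i = ≋-trans (+-≋ (toℕ-toFin-≋ (toℕ i + l)) (≋-refl {1}))
              (≋-trans (≡⇒≋ (trans (+-assoc (toℕ i) l 1) (cong (toℕ i +_) (+-comm l 1)))) (+m≋ (toℕ i)))

  prev-injective : ∀ {i j} → prev i ≡ prev j → i ≡ j
  prev-injective {i} {j} e = trans (sym (next-prev i)) (trans (cong next e) (next-prev j))

  toℕ-next≋-cast : ∀ {l′} (i : Fin (suc l′)) → l′ ≡ l → toℕ (next i) ≋ toℕ i + 1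
  toℕ-next≋-cast i refl = toℕ-next≋ i

  toℕ-mod≋-cast : ∀ {l′} → l′ ≡ l → (a : ℕ) → toℕ (a mod suc l′) ≋ a
  toℕ-mod≋-cast refl a = toℕ-toFin-≋ a

-- Cycles as periodic sequences

CEdge-sym : ∀ {H : Graph} (Z : Cycle H) {a b} → CEdge Z a b → CEdge Z b a
CEdge-sym Z (i , inj₁ (p , q)) = i , inj₂ (p , q)
CEdge-sym Z (i , inj₂ (p , q)) = i , inj₁ (p , q)

≈C-refl : ∀ {H : Graph} (Z : Cycle H) → Z ≈C Z
≈C-refl Z a b = mk⇔ id id

≈C-sym : ∀ {H : Graph} (Z Z′ : Cycle H) → Z ≈C Z′ → Z′ ≈C Z
≈C-sym _ _ e a b = mk⇔ (Equivalence.from (e a b)) (Equivalence.to (e a b))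

≈C-trans : ∀ {H : Graph} (Z Z′ Z′′ : Cycle H) → Z ≈C Z′ → Z′ ≈C Z′′ → Z ≈C Z′′
≈C-trans _ _ _ e e′ a b = mk⇔ (Equivalence.to (e′ a b) ∘ Equivalence.to (e a b))
                        (Equivalence.from (e a b) ∘ Equivalence.from (e′ a b))

data Direction : Set where
  forward backward : Direction

-- Vertices of a cycle indexed by all of ℕ, periodically; walking in the
-- backward direction is adding `l Z`, i.e. -1 modulo the length.
module OnCycle {H : Graph} (Z : Cycle H) where
  open Congruence (l Z)

  L : ℕ
  L = l Z

  W : ℕ → Fin (n H)
  W a = w Z (toFin a)

  W-cong : ∀ {a b} → a ≋ b → W a ≡ W b
  W-cong e = cong (w Z) (toFin-cong e)

  W-injective : ∀ a b → W a ≡ W b → a ≋ b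
  W-injective a b e = toFin-injective (w-inj Z e)

  w≡W : ∀ i → w Z i ≡ W (toℕ i)
  w≡W i = cong (w Z) (sym (toFin-toℕ i))

  w-next≡W : ∀ i → w Z (next i) ≡ W (toℕ i + 1)
  w-next≡W i = cong (w Z) (next≡toFin i)

  x+L+1≋x : ∀ x → x + L + 1 ≋ x
  x+L+1≋x x = ≋-trans (≡⇒≋ (trans (+-assoc x L 1) (cong (x +_) (+-comm L 1)))) (+m≋ x)

  edge-+1 : ∀ x → CEdge Z (W x) (W (x + 1))
  edge-+1 x = toFin x , inj₁ (refl , trans (W-cong (+-≋ (≋-sym (toℕ-toFin-≋ x)) (≋-refl {1})))
                                              (sym (w-next≡W (toFin x))))

  edge-+L : ∀ x → CEdge Z (W x) (W (x + L))
  edge-+L x = CEdge-sym Z (subst (CEdge Z (W (x + L))) (W-cong (x+L+1≋x x)) (edge-+1 (x + L)))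

  CEdge-neighbours : ∀ {b} x → CEdge Z (W x) b → (b ≡ W (x + 1)) ⊎ (b ≡ W (x + L))
  CEdge-neighbours x (i , inj₁ (p , q)) =
    inj₁ (trans q (trans (w-next≡W i) (W-cong (+-≋ (W-injective (toℕ i) x (trans (sym (w≡W i)) (sym p))) (≋-refl {1})))))
  CEdge-neighbours x (i , inj₂ (p , q)) = inj₂ (trans p (trans (w≡W i) (W-cong i≋x+L)))
    where
    i+1≋x : toℕ i + 1 ≋ x
    i+1≋x = W-injective (toℕ i + 1) x (trans (sym (w-next≡W i)) (sym q))
    i≋x+L : toℕ i ≋ x + L
    i≋x+L = ≋-trans (≋-sym (x+L+1≋x (toℕ i)))
              (≋-trans (≡⇒≋ (trans (+-assoc (toℕ i) L 1) (trans (cong (toℕ i +_) (+-comm L 1)) (sym (+-assoc (toℕ i) 1 L)))))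
                       (+-≋ i+1≋x (≋-refl {L})))

  stride : Direction → ℕ
  stride forward  = 1
  stride backward = L

  coStride : Direction → ℕ
  coStride forward  = L
  coStride backward = 1

  stride+coStride≡m : ∀ d → stride d + coStride d ≡ suc L
  stride+coStride≡m forward  = refl
  stride+coStride≡m backward = +-comm L 1

  stride²≋1 : ∀ d → stride d * stride d ≋ 1
  stride²≋1 forward  = ≋-refl
  stride²≋1 backward = l*l≋1

  stride-cancel : ∀ d {a b} → stride d * a ≋ stride d * b → a ≋ b
  stride-cancel forward  {a} {b} e = ≋-trans (≡⇒≋ (sym (*-identityˡ a))) (≋-trans e (≡⇒≋ (*-identityˡ b)))
  stride-cancel backward e = l*-cancel-≋ e

  edge-stride : ∀ d x → CEdge Z (W x) (W (x + stride d))
  edge-stride forward  = edge-+1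
  edge-stride backward = edge-+L

  CEdge-neighbours-stride : ∀ d {b} x → CEdge Z (W x) b → (b ≡ W (x + stride d)) ⊎ (b ≡ W (x + coStride d))
  CEdge-neighbours-stride forward  x e = CEdge-neighbours x e
  CEdge-neighbours-stride backward x e with CEdge-neighbours x e
  ... | inj₁ p = inj₂ p
  ... | inj₂ p = inj₁ p

  nonBacktracking⇒strided : (s : ℕ → Fin (n H)) (r : ℕ) → s 0 ≡ W r →
    (∀ j → CEdge Z (s j) (s (suc j))) → (∀ j → s (suc (suc j)) ≢ s j) →
    Σ Direction λ d → ∀ j → s j ≡ W (r + stride d * j)
  nonBacktracking⇒strided s r s0 edges noReturn = d , λ j → proj₁ (both j)
    where
    r+sj+s : ∀ r s j → r + s * suc j + s ≡ r + s * suc (suc j)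
    r+sj+s = solve-∀
    r+sj+t : ∀ r s t j → r + s * suc j + t ≡ (r + s * j) + (s + t)
    r+sj+t = solve-∀

    firstStep : Σ Direction λ d → s 1 ≡ W (r + stride d * 1)
    firstStep with CEdge-neighbours r (subst (λ t → CEdge Z t (s 1)) s0 (edges 0))
    ... | inj₁ p = forward , p
    ... | inj₂ p = backward , trans p (cong (λ t → W (r + t)) (sym (*-identityʳ L)))

    d : Direction
    d = proj₁ firstStep

    nextStep : ∀ j {b} → CEdge Z (W (r + stride d * suc j)) b → b ≢ W (r + stride d * j) →
               b ≡ W (r + stride d * suc (suc j))
    nextStep j e b≢ with CEdge-neighbours-stride d (r + stride d * suc j) e
    ... | inj₁ p = trans p (cong W (r+sj+s r (stride d) j))
    ... | inj₂ p = ⊥-elim (b≢ (trans p (W-cong (≋-trans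
                    (≡⇒≋ (trans (r+sj+t r (stride d) (coStride d) j) (cong ((r + stride d * j) +_) (stride+coStride≡m d))))
                    (+m≋ (r + stride d * j))))))

    both : ∀ j → (s j ≡ W (r + stride d * j)) × (s (suc j) ≡ W (r + stride d * suc j))
    both zero = trans s0 (cong W (sym (trans (cong (r +_) (*-zeroʳ (stride d))) (+-identityʳ r)))) , proj₂ firstStep
    both (suc j) with both j
    ... | p , q = q , nextStep j (subst (λ t → CEdge Z t (s (suc (suc j)))) q (edges (suc j)))
                                  (λ e → noReturn j (trans e (sym p)))

  module _ (T : Cycle H) (lT≡L : l T ≡ L) (r : ℕ) where
    private
      r+[y+Lr]≡y+rm : ∀ r y L → r + (y + L * r) ≡ y + r * suc L
      r+[y+Lr]≡y+rm = solve-∀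
      r+s[a+1]≡r+sa+s : ∀ r s a → r + s * (a + 1) ≡ (r + s * a) + s
      r+s[a+1]≡r+sa+s = solve-∀
      y+1+L≡y+L+1 : ∀ y L → y + 1 + L ≡ y + L + 1
      y+1+L≡y+L+1 = solve-∀

      Strided : Direction → Set
      Strided d = ∀ i → w T i ≡ W (r + stride d * toℕ i)

      wT-next : ∀ d → Strided d → ∀ i → w T (next i) ≡ W ((r + stride d * toℕ i) + stride d)
      wT-next d onZ i = trans (onZ (next i)) (W-cong (≋-trans (+-≋ (≋-refl {r}) (*-≋ (≋-refl {stride d}) (toℕ-next≋-cast i lT≡L)))
                                                             (≡⇒≋ (r+s[a+1]≡r+sa+s r (stride d) (toℕ i)))))

      edgeZ : ∀ d → Strided d → ∀ i → CEdge Z (w T i) (w T (next i))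
      edgeZ d onZ i = subst₂ (CEdge Z) (sym (onZ i)) (sym (wT-next d onZ i)) (edge-stride d (r + stride d * toℕ i))

      -- the index of W y in T: multiplying by the stride inverts it
      index : Direction → ℕ → Fin (suc (l T))
      index d y = (stride d * (y + L * r)) mod suc (l T)

      onZ-index : ∀ d → Strided d → ∀ y → w T (index d y) ≡ W y
      onZ-index d onZ y = trans (onZ (index d y)) (W-cong (begin
        r + stride d * toℕ (index d y)           ≈⟨ +-≋ (≋-refl {r}) (*-≋ (≋-refl {stride d}) (toℕ-mod≋-cast lT≡L _)) ⟩
        r + stride d * (stride d * (y + L * r))  ≈⟨ ≡⇒≋ (cong (r +_) (sym (*-assoc (stride d) (stride d) _))) ⟩
        r + stride d * stride d * (y + L * r)    ≈⟨ +-≋ (≋-refl {r}) (*-≋ (stride²≋1 d) (≋-refl {y + L * r})) ⟩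
        r + 1 * (y + L * r)                      ≈⟨ ≡⇒≋ (trans (cong (r +_) (*-identityˡ _)) (r+[y+Lr]≡y+rm r y L)) ⟩
        y + r * suc L                            ≈⟨ +-≋ (≋-refl {y}) (*m≋0 r) ⟩
        y + 0                                    ≈⟨ ≡⇒≋ (+-identityʳ y) ⟩
        y                                        ∎))
        where open ≋-Reasoning

      next-index : ∀ d → Strided d → ∀ y → w T (next (index d y)) ≡ W (y + stride d)
      next-index d onZ y = trans (wT-next d onZ (index d y))
        (W-cong (+-≋ (W-injective (r + stride d * toℕ (index d y)) y (trans (sym (onZ (index d y))) (onZ-index d onZ y))) (≋-refl {stride d})))

      edgeT : ∀ d → Strided d → ∀ y → CEdge T (W y) (W (y + 1))
      edgeT forward  onZ y = index forward y , inj₁ (sym (onZ-index forward onZ y) , sym (next-index forward onZ y))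
      edgeT backward onZ y = index backward (y + 1) , inj₂ (sym (onZ-index backward onZ (y + 1)) ,
        sym (trans (next-index backward onZ (y + 1)) (W-cong (≋-trans (≡⇒≋ (y+1+L≡y+L+1 y L)) (x+L+1≋x y)))))

    strided⇒≈C : ∀ d → (∀ i → w T i ≡ W (r + stride d * toℕ i)) → T ≈C Z
    strided⇒≈C d onZ a b = mk⇔ T→Z Z→T
      where
      T→Z : CEdge T a b → CEdge Z a b
      T→Z (i , inj₁ (p , q)) = subst₂ (CEdge Z) (sym p) (sym q) (edgeZ d onZ i)
      T→Z (i , inj₂ (p , q)) = CEdge-sym Z (subst₂ (CEdge Z) (sym p) (sym q) (edgeZ d onZ i))

      Z→T : CEdge Z a b → CEdge T a b
      Z→T (i , inj₁ (p , q)) = subst₂ (CEdge T) (sym (trans p (w≡W i))) (sym (trans q (w-next≡W i))) (edgeT d onZ (toℕ i))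
      Z→T (i , inj₂ (p , q)) = CEdge-sym T (subst₂ (CEdge T) (sym (trans p (w≡W i))) (sym (trans q (w-next≡W i))) (edgeT d onZ (toℕ i)))

module _ {H : Graph} (Z Z′ : Cycle H) (Z′⊆Z : ∀ a b → CEdge Z′ a b → CEdge Z a b) where
  open Congruence (l Z)
  open OnCycle Z
  private
    module Z′ = OnCycle Z′
    module M′ = Congruence (l Z′)

  subcycle-strided : ∀ r → w Z′ fzero ≡ W r → Σ Direction λ d → ∀ j → Z′.W j ≡ W (r + stride d * j)
  subcycle-strided r start = nonBacktracking⇒strided Z′.W r start
    (λ j → Z′⊆Z _ _ (subst (λ t → CEdge Z′ (Z′.W j) (Z′.W t)) (+-comm j 1) (Z′.edge-+1 j))) noReturn
    where
    2≢0 : ¬ (2 M′.≋ 0)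
    2≢0 (M′.mk q) with trans (sym (m<n⇒m%n≡m (s≤s (l≥2 Z′)))) q
    ... | ()
    noReturn : ∀ j → Z′.W (suc (suc j)) ≢ Z′.W j
    noReturn j e = 2≢0 (M′.+-cancelˡ-≋ {2} {0} {j}
      (M′.≋-trans (M′.≡⇒≋ (+-comm j 2)) (M′.≋-trans (Z′.W-injective (suc (suc j)) j e) (M′.≡⇒≋ (sym (+-identityʳ j))))))

  subcycle-length≤ : ∀ r → w Z′ fzero ≡ W r → l Z′ ≤ l Z
  subcycle-length≤ r start = ≤-pred (FP.injective⇒≤ {f = position} position-injective)
    where
    d = proj₁ (subcycle-strided r start)
    onZ = proj₂ (subcycle-strided r start)
    position : Fin (suc (l Z′)) → Fin (suc (l Z))
    position i = toFin (r + stride d * toℕ i)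
    position-injective : Injective _≡_ _≡_ position
    position-injective {i} {j} e = w-inj Z′
      (trans (Z′.w≡W i) (trans (onZ (toℕ i)) (trans (cong (w Z) e) (sym (trans (Z′.w≡W j) (onZ (toℕ j)))))))

≈C-sameStart : ∀ {H : Graph} (Z Z′ : Cycle H) → Z ≈C Z′ → w Z′ fzero ≡ w Z fzero →
  (l Z′ ≡ l Z) × (Σ Direction λ d → ∀ j → OnCycle.W Z′ j ≡ OnCycle.W Z (0 + OnCycle.stride Z d * j))
≈C-sameStart Z Z′ Z≈Z′ start =
  ≤-antisym (subcycle-length≤ Z Z′ Z′⊆Z 0 start) (subcycle-length≤ Z′ Z Z⊆Z′ 0 (sym start)) ,
  subcycle-strided Z Z′ Z′⊆Z 0 start
  where
  Z′⊆Z : ∀ a b → CEdge Z′ a b → CEdge Z a b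
  Z′⊆Z a b = Equivalence.from (Z≈Z′ a b)
  Z⊆Z′ : ∀ a b → CEdge Z a b → CEdge Z′ a b
  Z⊆Z′ a b = Equivalence.to (Z≈Z′ a b)

count : ∀ {n} → (Fin n → Bool) → ℕ
count {zero}  p = 0
count {suc n} p = (if p fzero then 1 else 0) + count (p ∘ fsuc)

sum-indicator≡count : ∀ {n} (p : Fin n → Bool) → sum (List.tabulate (λ u → if p u then 1 else 0)) ≡ count p
sum-indicator≡count {zero}  p = refl
sum-indicator≡count {suc n} p = cong ((if p fzero then 1 else 0) +_) (sum-indicator≡count (p ∘ fsuc))

deg≡count : ∀ (G : Graph) v → deg G v ≡ count (Adj G v)
deg≡count G v = trans (cong sum (ListP.map-tabulate id (λ u → if Adj G v u then 1 else 0))) (sum-indicator≡count (Adj G v))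

injection≤count : ∀ {n m} (p : Fin n → Bool) (h : Fin m → Fin n) → Injective _≡_ _≡_ h →
                  (∀ a → p (h a) ≡ true) → m ≤ count p
injection≤count {zero} {zero} p h h-inj hp = z≤n
injection≤count {zero} {suc m} p h h-inj hp with h fzero
... | ()
injection≤count {suc n} {m} p h h-inj hp with FP.any? (λ a → h a FP.≟ fzero)
... | no missed = ≤-trans (injection≤count (p ∘ fsuc) h′ h′-inj h′-p) (m≤n+m _ _)
  where
  h′ : Fin m → Fin n
  h′ a = punchOut {i = fzero} (λ e → missed (a , sym e))
  fsuc-h′ : ∀ a → fsuc (h′ a) ≡ h a
  fsuc-h′ a = FP.punchIn-punchOut {i = fzero} (λ e → missed (a , sym e))
  h′-inj : Injective _≡_ _≡_ h′
  h′-inj {a} {b} e = h-inj (trans (sym (fsuc-h′ a)) (trans (cong fsuc e) (fsuc-h′ b)))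
  h′-p : ∀ a → p (fsuc (h′ a)) ≡ true
  h′-p a = trans (cong p (fsuc-h′ a)) (hp a)
injection≤count {suc n} {suc m} p h h-inj hp | yes (a₀ , ha₀) rewrite trans (cong p (sym ha₀)) (hp a₀) =
  s≤s (injection≤count (p ∘ fsuc) h′ h′-inj h′-p)
  where
  avoids : ∀ b → fzero ≢ h (punchIn a₀ b)
  avoids b e = FP.punchInᵢ≢i a₀ b (sym (h-inj (trans ha₀ e)))
  h′ : Fin m → Fin n
  h′ b = punchOut (avoids b)
  fsuc-h′ : ∀ b → fsuc (h′ b) ≡ h (punchIn a₀ b)
  fsuc-h′ b = FP.punchIn-punchOut (avoids b)
  h′-inj : Injective _≡_ _≡_ h′
  h′-inj {a} {b} e = FP.punchIn-injective a₀ a b (h-inj (trans (sym (fsuc-h′ a)) (trans (cong fsuc e) (fsuc-h′ b))))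
  h′-p : ∀ b → p (fsuc (h′ b)) ≡ true
  h′-p b = trans (cong p (fsuc-h′ b)) (hp (punchIn a₀ b))

-- The neighbourhood of a vertex of degree k

module CriticalVertex (k′ : ℕ) (G : Graph) (crit : Critical (suc (suc (suc k′))) G)
                      (mindeg : MinDegree G (suc (suc (suc k′)))) where
  k : ℕ
  k = suc (suc (suc k′))

  N : ℕ
  N = n G

  v : Fin N
  v = proj₁ (proj₂ mindeg)

  deg-v : deg G v ≡ k
  deg-v = proj₂ (proj₂ mindeg)

  isv : Fin N → Bool
  isv x = does (x FP.≟ v)

  isv-≢ : ∀ {x} → x ≢ v → isv x ≡ false
  isv-≢ {x} x≢v with x FP.≟ v
  ... | yes e = ⊥-elim (x≢v e)
  ... | no _  = refl

  adj-v-≢ : ∀ {y} → Adj G v y ≡ true → y ≢ v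
  adj-v-≢ adj refl with trans (sym adj) (adj-irr G v)
  ... | ()

  G-v : Subgraph G
  G-v = record
    { V∈    = λ x → not (isv x)
    ; E∈    = λ x y → Adj G x y ∧ (not (isv x) ∧ not (isv y))
    ; E-sym = E-sym′
    ; E-sub = E-sub′ }
    where
    E-sym′ : ∀ x y → Adj G x y ∧ (not (isv x) ∧ not (isv y)) ≡ Adj G y x ∧ (not (isv y) ∧ not (isv x))
    E-sym′ x y rewrite adj-sym G x y | BP.∧-comm (not (isv x)) (not (isv y)) = refl
    E-sub′ : ∀ x y → Adj G x y ∧ (not (isv x) ∧ not (isv y)) ≡ true →
             (Adj G x y ≡ true) × (not (isv x) ≡ true) × (not (isv y) ≡ true)
    E-sub′ x y e with Adj G x y | isv x | isv y
    ... | true | false | false = refl , refl , refl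
    E-sub′ x y () | false | _    | _
    E-sub′ x y () | true  | true | _
    E-sub′ x y () | true  | false | true

  G-v-proper : IsProper G-v
  G-v-proper = inj₁ (v , cong not isv-v)
    where
    isv-v : isv v ≡ true
    isv-v with v FP.≟ v
    ... | yes _  = refl
    ... | no v≢v = ⊥-elim (v≢v refl)

  ProperOnG-v : (Fin N → Fin k) → Set
  ProperOnG-v ψ = ∀ x y → Adj G x y ≡ true → x ≢ v → y ≢ v → ψ x ≢ ψ y

  φ : Fin N → Fin k
  φ = proj₁ (proj₂ crit G-v G-v-proper)

  φ-proper : ProperOnG-v φ
  φ-proper x y adj x≢v y≢v = proj₂ (proj₂ crit G-v G-v-proper) x y edge
    where
    edge : Adj G x y ∧ (not (isv x) ∧ not (isv y)) ≡ true
    edge rewrite adj | isv-≢ x≢v | isv-≢ y≢v = refl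

  -- Otherwise v could take the missing colour, and G would be k-colourable.
  allColoursAround-v : (ψ : Fin N → Fin k) → ProperOnG-v ψ →
                       (a : Fin k) → ¬ (∀ y → Adj G v y ≡ true → ψ y ≢ a)
  allColoursAround-v ψ ψ-proper a missing = 1+n≰n (proj₂ (proj₁ crit) k (χ , χ-proper))
    where
    χ : Fin N → Fin k
    χ x with x FP.≟ v
    ... | yes _ = a
    ... | no _  = ψ x
    χ-v : χ v ≡ a
    χ-v with v FP.≟ v
    ... | yes _  = refl
    ... | no v≢v = ⊥-elim (v≢v refl)
    χ-≢ : ∀ {x} → x ≢ v → χ x ≡ ψ x
    χ-≢ {x} x≢v with x FP.≟ v
    ... | yes e = ⊥-elim (x≢v e)
    ... | no _  = refl
    χ-proper : ∀ x y → Adj G x y ≡ true → χ x ≢ χ y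
    χ-proper x y adj = byCases (x FP.≟ v) (y FP.≟ v)
      where
      byCases : Dec (x ≡ v) → Dec (y ≡ v) → χ x ≢ χ y
      byCases (yes refl) (yes refl) _ = adj-v-≢ adj refl
      byCases (yes refl) (no y≢v)   e = missing y adj (trans (sym (χ-≢ y≢v)) (trans (sym e) χ-v))
      byCases (no x≢v)   (yes refl) e = missing x (trans (adj-sym G v x) adj) (trans (sym (χ-≢ x≢v)) (trans e χ-v))
      byCases (no x≢v)   (no y≢v)   e = ψ-proper x y adj x≢v y≢v (trans (sym (χ-≢ x≢v)) (trans e (χ-≢ y≢v)))

  neighbourOfColour : (a : Fin k) → Σ (Fin N) λ y → (Adj G v y ≡ true) × (φ y ≡ a)
  neighbourOfColour a with FP.any? (λ y → (Adj G v y BP.≟ true) ×-dec (φ y FP.≟ a))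
  ... | yes p  = p
  ... | no ¬p = ⊥-elim (allColoursAround-v φ φ-proper a (λ y adj e → ¬p (y , adj , e)))

  u : Fin k → Fin N
  u a = proj₁ (neighbourOfColour a)

  u-adj : ∀ a → Adj G v (u a) ≡ true
  u-adj a = proj₁ (proj₂ (neighbourOfColour a))

  φ-u : ∀ a → φ (u a) ≡ a
  φ-u a = proj₂ (proj₂ (neighbourOfColour a))

  u-injective : ∀ {a b} → u a ≡ u b → a ≡ b
  u-injective {a} {b} e = trans (sym (φ-u a)) (trans (cong φ e) (φ-u b))

  u-≢v : ∀ a → u a ≢ v
  u-≢v a = adj-v-≢ (u-adj a)

  -- v has only k neighbours, and the k vertices u a are among them.
  neighbour≡u : ∀ y → Adj G v y ≡ true → y ≡ u (φ y)
  neighbour≡u y adj with y FP.≟ u (φ y)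
  ... | yes p = p
  ... | no y≢ = ⊥-elim (1+n≰n (≤-trans (injection≤count (Adj G v) h h-inj h-adj)
                                        (≤-reflexive (trans (sym (deg≡count G v)) deg-v))))
    where
    h : Fin (suc k) → Fin N
    h fzero    = y
    h (fsuc a) = u a
    h-inj : Injective _≡_ _≡_ h
    h-inj {fzero}  {fzero}  e = refl
    h-inj {fzero}  {fsuc b} e = ⊥-elim (y≢ (trans e (cong u (sym (trans (cong φ e) (φ-u b))))))
    h-inj {fsuc a} {fzero}  e = ⊥-elim (y≢ (trans (sym e) (cong u (sym (trans (cong φ (sym e)) (φ-u a))))))
    h-inj {fsuc a} {fsuc b} e = cong fsuc (u-injective e)
    h-adj : ∀ a → Adj G v (h a) ≡ true
    h-adj fzero    = adj
    h-adj (fsuc a) = u-adj a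

-- Arc walks along a colour pattern

module ColourPattern (k′ : ℕ) (G : Graph) (crit : Critical (suc (suc (suc k′))) G)
                     (mindeg : MinDegree G (suc (suc (suc k′))))
                     (l : ℕ) (P : Fin (suc l) → Fin (suc (suc (suc k′)))) (P-inj : Injective _≡_ _≡_ P) where
  open CriticalVertex k′ G crit mindeg
  open Congruence l
  open Walks (FP._≟_ {N})

  Pℕ : ℕ → Fin k
  Pℕ a = P (toFin a)

  Arc : Fin N → Fin N → Set
  Arc x y = (Adj G x y ≡ true) × (x ≢ v) × (y ≢ v) × Σ (Fin m) λ i → (P i ≡ φ x) × (P (next i) ≡ φ y)

  Arc? : ∀ x y → Dec (Arc x y)
  Arc? x y = (Adj G x y BP.≟ true) ×-dec (¬? (x FP.≟ v) ×-dec (¬? (y FP.≟ v) ×-dec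
             FP.any? (λ i → (P i FP.≟ φ x) ×-dec (P (next i) FP.≟ φ y))))

  arc-colour : ∀ {x y} a → Arc x y → φ x ≡ Pℕ a → φ y ≡ Pℕ (a + 1)
  arc-colour a (_ , _ , _ , i , Pi , Pnext) φx = trans (sym Pnext) (cong P
    (trans (cong next (P-inj (trans Pi φx))) (trans (next≡toFin (toFin a)) (toFin-cong (+-≋ (toℕ-toFin-≋ a) (≋-refl {1}))))))

  walk-colours : ∀ {a b ws} → Walk Arc a b ws → ∀ s → φ a ≡ Pℕ s →
                 ∀ i → i < length ws → φ (nth ws i a) ≡ Pℕ (s + i)
  walk-colours {a} w s φa zero _ = trans (cong φ (walk-head a w)) (trans φa (cong Pℕ (sym (+-identityʳ s))))
  walk-colours {a} w s φa (suc i) p =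
    trans (arc-colour (s + i) (walk-edge a w i p) (walk-colours w s φa i (≤-trans (n≤1+n (suc i)) p)))
          (cong Pℕ (trans (+-assoc s i 1) (cong (s +_) (+-comm i 1))))

  unique-length≤ : ∀ {ws} → Unique ws → length ws ≤ N
  unique-length≤ {[]}     _ = z≤n
  unique-length≤ {x ∷ ws} u = FP.injective⇒≤ {f = index} index-injective
    where
    index : Fin (length (x ∷ ws)) → Fin N
    index i = nth (x ∷ ws) (toℕ i) x
    index-injective : Injective _≡_ _≡_ index
    index-injective {i} {j} e = FP.toℕ-injective (nth-injective u (toℕ i) (toℕ j) x (FP.toℕ<n i) (FP.toℕ<n j) e)

  -- Vertices with an arc walk to b, computed by N rounds of backward search.
  module ReachSet (b : Fin N) where
    reaches≤ : ℕ → Fin N → Bool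
    reaches≤ zero    y = does (y FP.≟ b)
    reaches≤ (suc t) y = reaches≤ t y ∨ does (FP.any? (λ z → Arc? y z ×-dec (reaches≤ t z BP.≟ true)))

    reaches≤-sound : ∀ t y → reaches≤ t y ≡ true → Σ (List (Fin N)) λ ws → Walk Arc y b ws
    reaches≤-sound zero y e with y FP.≟ b
    ... | yes refl = _ , done
    reaches≤-sound zero y () | no _
    reaches≤-sound (suc t) y e with reaches≤ t y in eq
    ... | true = reaches≤-sound t y eq
    ... | false with FP.any? (λ z → Arc? y z ×-dec (reaches≤ t z BP.≟ true))
    ...   | yes (z , a , rz) = _ , step a (proj₂ (reaches≤-sound t z rz))
    reaches≤-sound (suc t) y () | false | no _

    reaches≤-complete : ∀ t y {ws} → Walk Arc y b ws → length ws ≤ suc t → reaches≤ t y ≡ true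
    reaches≤-complete zero y done _ with y FP.≟ y
    ... | yes _  = refl
    ... | no y≢y = ⊥-elim (y≢y refl)
    reaches≤-complete zero y (step a w) (s≤s le) = ⊥-elim (1+n≰n (≤-trans (walk-nonempty w) le))
    reaches≤-complete (suc t) y done le rewrite reaches≤-complete t y done (s≤s z≤n) = refl
    reaches≤-complete (suc t) y (step {c = z} a w) (s≤s le) with reaches≤ t y
    ... | true = refl
    ... | false with FP.any? (λ z → Arc? y z ×-dec (reaches≤ t z BP.≟ true))
    ...   | yes _ = refl
    ...   | no ¬p = ⊥-elim (¬p (z , a , reaches≤-complete t z w le))

    Reaches : Fin N → Bool
    Reaches = reaches≤ N

    Reaches-sound : ∀ y → Reaches y ≡ true → Σ (List (Fin N)) λ ws → Walk Arc y b ws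
    Reaches-sound = reaches≤-sound N

    -- loop erasure bounds the walk length by N
    Reaches-closed : ∀ x y → Arc x y → Reaches y ≡ true → Reaches x ≡ true
    Reaches-closed x y a ry with loopErase (step a (proj₂ (Reaches-sound y ry)))
    ... | _ , w , uw = reaches≤-complete N x w (≤-trans (unique-length≤ uw) (n≤1+n N))

    Reaches-target : Reaches b ≡ true
    Reaches-target = reaches≤-complete N b done (s≤s z≤n)

  module Recolour (S : Fin N → Bool) (S-closed : ∀ x y → Arc x y → S y ≡ true → S x ≡ true) where
    Shifted : Fin N → Set
    Shifted x = (S x ≡ true) × (x ≢ v) × Σ (Fin m) λ i → P i ≡ φ x

    shifted? : ∀ x → Dec (Shifted x)
    shifted? x = (S x BP.≟ true) ×-dec (¬? (x FP.≟ v) ×-dec FP.any? (λ i → P i FP.≟ φ x))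

    ψ′ : ∀ x → Dec (Shifted x) → Fin k
    ψ′ x (yes (_ , _ , i , _)) = P (prev i)
    ψ′ x (no _)                = φ x

    ψ : Fin N → Fin k
    ψ x = ψ′ x (shifted? x)

    ψ-cases : ∀ x → (Σ (Shifted x) λ s → ψ x ≡ P (prev (proj₁ (proj₂ (proj₂ s))))) ⊎ ((¬ Shifted x) × ψ x ≡ φ x)
    ψ-cases x with shifted? x
    ... | yes s = inj₁ (s , refl)
    ... | no ¬s = inj₂ (¬s , refl)

    -- such a y would have an arc into x, hence lie in S
    shiftedSpreads : ∀ x y → Adj G x y ≡ true → x ≢ v → y ≢ v → (s : Shifted x) → ¬ Shifted y →
                     P (prev (proj₁ (proj₂ (proj₂ s)))) ≢ φ y
    shiftedSpreads x y adj x≢v y≢v (sx , _ , i , Pi) ¬sy Pprev =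
      ¬sy (S-closed y x (trans (adj-sym G y x) adj , y≢v , x≢v , prev i , Pprev , trans (cong P (next-prev i)) Pi) sx ,
           y≢v , prev i , Pprev)

    ψ-proper : ProperOnG-v ψ
    ψ-proper x y adj x≢v y≢v with ψ-cases x | ψ-cases y
    ... | inj₁ ((_ , _ , i , Pi) , ψx) | inj₁ ((_ , _ , j , Pj) , ψy) = λ e →
      φ-proper x y adj x≢v y≢v (trans (sym Pi) (trans (cong P (prev-injective (P-inj (trans (sym ψx) (trans e ψy))))) Pj))
    ... | inj₁ (sx , ψx) | inj₂ (¬sy , ψy) = λ e →
      shiftedSpreads x y adj x≢v y≢v sx ¬sy (trans (sym ψx) (trans e ψy))
    ... | inj₂ (¬sx , ψx) | inj₁ (sy , ψy) = λ e →
      shiftedSpreads y x (trans (adj-sym G y x) adj) y≢v x≢v sy ¬sx (trans (sym ψy) (trans (sym e) ψx))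
    ... | inj₂ (_ , ψx) | inj₂ (_ , ψy) = λ e → φ-proper x y adj x≢v y≢v (trans (sym ψx) (trans e ψy))

    colourMissing : ∀ t → S (u (P t)) ≡ true → S (u (P (next t))) ≡ false →
                    ∀ y → Adj G v y ≡ true → ψ y ≢ P t
    colourMissing t st ¬snext y adj e with ψ-cases y
    ... | inj₁ ((sy , _ , i , Pi) , ψy) = case trans (sym sy) (trans (cong S y≡) ¬snext) of λ ()
      where
      i≡ : i ≡ next t
      i≡ = trans (sym (next-prev i)) (cong next (P-inj (trans (sym ψy) e)))
      y≡ : y ≡ u (P (next t))
      y≡ = trans (neighbour≡u y adj) (cong u (trans (sym Pi) (cong P i≡)))
    ... | inj₂ (¬sy , ψy) = ¬sy (trans (cong S y≡) st , adj-v-≢ adj , t , sym (trans (sym ψy) e))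
      where
      y≡ : y ≡ u (P t)
      y≡ = trans (neighbour≡u y adj) (cong u (trans (sym ψy) e))

    S-propagates : ∀ t → S (u (P t)) ≡ true → S (u (P (next t))) ≡ true
    S-propagates t st with S (u (P (next t))) in eq
    ... | true  = refl
    ... | false = ⊥-elim (allColoursAround-v ψ ψ-proper (P t) (colourMissing t st eq))

  arcWalk : ∀ s t → Σ (List (Fin N)) λ ws → Walk Arc (u (P s)) (u (P t)) ws
  arcWalk s t = Reaches-sound (u (P s)) (subst (λ i → Reaches (u (P i)) ≡ true) t+j≡s (reachesAll j))
    where
    open ReachSet (u (P t))
    open Recolour Reaches Reaches-closed

    reachesAll : ∀ j → Reaches (u (P (toFin (toℕ t + j)))) ≡ true
    reachesAll zero = subst (λ i → Reaches (u (P i)) ≡ true)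
                            (sym (trans (cong toFin (+-identityʳ (toℕ t))) (toFin-toℕ t))) Reaches-target
    reachesAll (suc j) = subst (λ i → Reaches (u (P i)) ≡ true)
                               (trans (next≡toFin (toFin (toℕ t + j))) (toFin-cong t+j+1≋))
                               (S-propagates _ (reachesAll j))
      where
      t+j+1≋ : toℕ (toFin (toℕ t + j)) + 1 ≋ toℕ t + suc j
      t+j+1≋ = ≋-trans (+-≋ (toℕ-toFin-≋ (toℕ t + j)) (≋-refl {1}))
                       (≡⇒≋ (trans (+-assoc (toℕ t) j 1) (cong (toℕ t +_) (+-comm j 1))))

    j : ℕ
    j = toℕ s + l * toℕ t

    t+j≡s : toFin (toℕ t + j) ≡ s
    t+j≡s = trans (toFin-cong (≋-trans (≡⇒≋ (t+[s+lt]≡s+tm (toℕ t) (toℕ s) l)) (≋-trans (+-≋ (≋-refl {toℕ s}) (*m≋0 (toℕ t))) (≡⇒≋ (+-identityʳ (toℕ s))))))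
                  (toFin-toℕ s)
      where
      t+[s+lt]≡s+tm : ∀ t s l → t + (s + l * t) ≡ s + t * suc l
      t+[s+lt]≡s+tm = solve-∀

-- Realising cycles of K_{k+1} in G

module _ (H : Graph) (R : Fin (n H) → Fin (n H) → Set) (R⇒Adj : ∀ {x y} → R x y → Adj H x y ≡ true)
         (x₀ x₁ x₂ : Fin (n H)) (rest : List (Fin (n H))) where
  open Walks (FP._≟_ {n H})

  private
    xs : List (Fin (n H))
    xs = x₀ ∷ x₁ ∷ x₂ ∷ rest

    L : ℕ
    L = suc (suc (length rest))

  module _ (uniq : Unique xs) (steps : ∀ i → suc i < length xs → R (nth xs i x₀) (nth xs (suc i) x₀))
           (closing : R (nth xs L x₀) x₀) where

    listCycle-vertex : Fin (suc L) → Fin (n H)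
    listCycle-vertex i = nth xs (toℕ i) x₀

    listCycle-R : ∀ i → R (listCycle-vertex i) (listCycle-vertex (next i))
    listCycle-R i with m≤n⇒m<n∨m≡n (≤-pred (FP.toℕ<n i))
    ... | inj₁ i<L = subst (λ t → R (listCycle-vertex i) (nth xs t x₀)) (sym (Congruence.toℕ-next-< L i i<L)) (steps (toℕ i) (s≤s i<L))
    ... | inj₂ i≡L = subst₂ (λ a b → R (nth xs a x₀) (listCycle-vertex b)) (sym i≡L) (sym (Congruence.next-last L i i≡L)) closing

    listCycle : Cycle H
    listCycle = record
      { l     = L
      ; l≥2   = s≤s (s≤s z≤n)
      ; w     = listCycle-vertex
      ; w-inj = λ {i} {j} e → FP.toℕ-injective (nth-injective uniq (toℕ i) (toℕ j) x₀ (FP.toℕ<n i) (FP.toℕ<n j) e)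
      ; w-adj = λ i → R⇒Adj (listCycle-R i) }

-- The edges of G whose ends are coloured p - 1 and q - 1 (vertex 0 of K_{k+1} stands for v).
ColouredEdge : ∀ {k} (G : Graph) → (Fin (n G) → Fin k) → Cycle G → Fin (suc k) → Fin (suc k) → Set
ColouredEdge G φ Z p q = Σ (Fin (n G)) λ a → Σ (Fin (n G)) λ b → CEdge Z a b × (fsuc (φ a) ≡ p) × (fsuc (φ b) ≡ q)

-- A cycle R of K_{k+1} avoiding vertex 0 is read as a cyclic colour pattern P, and
-- realised by a cycle of G - v following P, closed up through an arc out of u (P 0).
module AvoidingZero (k′ : ℕ) (G : Graph) (crit : Critical (suc (suc (suc k′))) G)
                    (mindeg : MinDegree G (suc (suc (suc k′))))
                    (R : Cycle (K (suc (suc (suc (suc k′)))))) (avoids0 : ∀ j → w R j ≢ fzero) where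
  open CriticalVertex k′ G crit mindeg

  P : Fin (suc (l R)) → Fin k
  P j = punchOut (≢-sym (avoids0 j))

  fsuc-P : ∀ j → fsuc (P j) ≡ w R j
  fsuc-P j = FP.punchIn-punchOut (≢-sym (avoids0 j))

  P-inj : Injective _≡_ _≡_ P
  P-inj {i} {j} e = w-inj R (FP.punchOut-injective (≢-sym (avoids0 i)) (≢-sym (avoids0 j)) e)

  open ColourPattern k′ G crit mindeg (l R) P P-inj
  open Congruence (l R)
  open Walks (FP._≟_ {N})

  1<m : 1 < m
  1<m = s≤s (≤-trans (s≤s z≤n) (l≥2 R))

  u₀ u₁ : Fin N
  u₀ = u (P fzero)
  u₁ = u (P (toFin 1))

  u₀≢u₁ : u₀ ≢ u₁
  u₀≢u₁ e = 0≢1+n (trans (cong toℕ (P-inj (u-injective e))) (toℕ-toFin-small 1<m))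

  firstArc : Σ (Fin N) λ c → Arc u₀ c × Σ (List (Fin N)) λ ws → Walk Arc c u₁ ws
  firstArc = firstEdge (proj₂ (arcWalk fzero (toFin 1))) u₀≢u₁

  c : Fin N
  c = proj₁ firstArc

  u₀→c : Arc u₀ c
  u₀→c = proj₁ (proj₂ firstArc)

  path : Σ (List (Fin N)) λ ws → Walk Arc (proj₁ firstArc) u₀ ws × Unique ws
  path = loopErase (proj₂ (proj₂ (proj₂ (proj₂ firstArc)) ++ʷ proj₂ (arcWalk (toFin 1) fzero)))

  zs : List (Fin N)
  zs = proj₁ path

  c→u₀ : Walk Arc c u₀ zs
  c→u₀ = proj₁ (proj₂ path)

  zs-unique : Unique zs
  zs-unique = proj₂ (proj₂ path)

  zs-colours : ∀ i → i < length zs → φ (nth zs i c) ≡ Pℕ (1 + i)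
  zs-colours = walk-colours c→u₀ 1 (arc-colour 0 u₀→c (φ-u (P fzero)))

  -- the last vertex is u₀, of colour P 0
  length-zs≋0 : length zs ≋ 0
  length-zs≋0 = toFin-injective (P-inj (trans (sym lastColour) (trans (cong φ (walk-last c c→u₀)) (φ-u (P fzero)))))
    where
    lastColour : φ (nth zs (pred (length zs)) c) ≡ Pℕ (length zs)
    lastColour = trans (zs-colours _ (subst (pred (length zs) <_) sp ≤-refl)) (cong Pℕ sp)
      where
      sp : suc (pred (length zs)) ≡ length zs
      sp = suc-pred (length zs) {{>-nonZero (walk-nonempty c→u₀)}}

  record Realisation : Set where
    field
      cycle   : Cycle G
      arcs    : ∀ i → Arc (w cycle i) (w cycle (next i))
      covers  : ∀ (j : Fin m) → Σ (Fin (suc (l cycle))) λ i → φ (w cycle i) ≡ P j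
      m∣len   : m ∣ len cycle

  realise : (xs : List (Fin N)) → Walk Arc c u₀ xs → Unique xs →
            (∀ i → i < length xs → φ (nth xs i c) ≡ Pℕ (1 + i)) → length xs ≋ 0 → Realisation
  realise [] () _ _ _
  realise (_ ∷ []) _ _ _ (mk e) with trans (sym (m<n⇒m%n≡m 1<m)) e
  ... | ()
  realise (_ ∷ _ ∷ []) _ _ _ (mk e) with trans (sym (m<n⇒m%n≡m (s≤s (l≥2 R)))) e
  ... | ()
  realise xs@(x₀ ∷ x₁ ∷ x₂ ∷ rest) walk uniq cols len≋0 = record
    { cycle  = listCycle G Arc proj₁ x₀ x₁ x₂ rest uniq steps closing
    ; arcs   = listCycle-R G Arc proj₁ x₀ x₁ x₂ rest uniq steps closing
    ; covers = covers
    ; m∣len  = m%n≡0⇒n∣m (length xs) m (get len≋0) }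
    where
    steps : ∀ i → suc i < length xs → Arc (nth xs i x₀) (nth xs (suc i) x₀)
    steps = walk-edge x₀ walk
    closing : Arc (nth xs (suc (suc (length rest))) x₀) x₀
    closing = subst₂ Arc (sym (walk-last x₀ walk)) (sym (walk-head x₀ walk)) u₀→c
    m≤len : m ≤ length xs
    m≤len with m ≤? length xs
    ... | yes p = p
    ... | no ¬p with trans (sym (m<n⇒m%n≡m (≰⇒> ¬p))) (get len≋0)
    ...   | ()
    covers : ∀ (j : Fin m) → Σ (Fin (length xs)) λ i → φ (nth xs (toℕ i) x₀) ≡ P j
    covers j = fromℕ< t<len , trans (cong φ (trans (cong (λ t → nth xs t x₀) (FP.toℕ-fromℕ< t<len)) (nth-irrelevant xs t x₀ c t<len)))
                                     (trans (cols t t<len) (cong P (trans (toFin-cong 1+t≋j) (toFin-toℕ j))))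
      where
      t = (toℕ j + l R) % m
      t<len : t < length xs
      t<len = ≤-trans (m%n<n (toℕ j + l R) m) m≤len
      1+t≋j : 1 + t ≋ toℕ j
      1+t≋j = ≋-trans (+-≋ (≋-refl {1}) (%-≋ (toℕ j + l R)))
              (≋-trans (≡⇒≋ (trans (+-comm 1 (toℕ j + l R)) (trans (+-assoc (toℕ j) (l R) 1) (cong (toℕ j +_) (+-comm (l R) 1)))))
                       (+m≋ (toℕ j)))

  opaque
    realisation : Realisation
    realisation = realise zs c→u₀ zs-unique zs-colours length-zs≋0

  open Realisation realisation public

  decode : ∀ p q → CEdge R p q ⇔ ColouredEdge G φ cycle p q
  decode p q = mk⇔ encode decode′
    where
    arcAt : ∀ j → Σ (Fin (suc (l cycle))) λ i → (φ (w cycle i) ≡ P j) × (φ (w cycle (next i)) ≡ P (next j))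
    arcAt j with covers j
    ... | i , φi with arcs i
    ...   | _ , _ , _ , j′ , Pj′ , Pnext = i , φi , trans (sym Pnext) (cong (P ∘ next) (P-inj (trans Pj′ φi)))
    encode : CEdge R p q → ColouredEdge G φ cycle p q
    encode (j , inj₁ (p≡ , q≡)) with arcAt j
    ... | i , φi , φnext = _ , _ , (i , inj₁ (refl , refl)) ,
          trans (cong fsuc φi) (trans (fsuc-P j) (sym p≡)) , trans (cong fsuc φnext) (trans (fsuc-P (next j)) (sym q≡))
    encode (j , inj₂ (q≡ , p≡)) with arcAt j
    ... | i , φi , φnext = _ , _ , (i , inj₂ (refl , refl)) ,
          trans (cong fsuc φnext) (trans (fsuc-P (next j)) (sym p≡)) , trans (cong fsuc φi) (trans (fsuc-P j) (sym q≡))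
    decode′ : ColouredEdge G φ cycle p q → CEdge R p q
    decode′ (a , b , (i , inj₁ (a≡ , b≡)) , pa , pb) with arcs i
    ... | _ , _ , _ , j , Pj , Pnext =
      j , inj₁ (trans (sym pa) (trans (cong fsuc (trans (cong φ a≡) (sym Pj))) (fsuc-P j)) ,
                trans (sym pb) (trans (cong fsuc (trans (cong φ b≡) (sym Pnext))) (fsuc-P (next j))))
    decode′ (a , b , (i , inj₂ (b≡ , a≡)) , pa , pb) with arcs i
    ... | _ , _ , _ , j , Pj , Pnext =
      j , inj₂ (trans (sym pb) (trans (cong fsuc (trans (cong φ b≡) (sym Pj))) (fsuc-P j)) ,
                trans (sym pa) (trans (cong fsuc (trans (cong φ a≡) (sym Pnext))) (fsuc-P (next j))))

-- A cycle R of K_{k+1} through vertex 0 = (0, r₁, …, r_l) becomes the pattern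
-- P = (d, r₁ - 1, …, r_l - 1) for a colour d unused by R (R has at most k
-- vertices), realised as v followed by an arc path from u (P 1) to u (P l).
module ThroughZero (k′ : ℕ) (G : Graph) (crit : Critical (suc (suc (suc k′))) G)
                   (mindeg : MinDegree G (suc (suc (suc k′))))
                   (R : Cycle (K (suc (suc (suc (suc k′)))))) (R₀≡0 : w R fzero ≡ fzero)
                   (short : len R ≤ suc (suc (suc k′))) where
  open CriticalVertex k′ G crit mindeg

  R≢0 : ∀ j → j ≢ fzero → w R j ≢ fzero
  R≢0 j j≢0 e = j≢0 (w-inj R (trans e (sym R₀≡0)))

  unusedColour : Σ (Fin k) λ d → ∀ j → w R j ≢ fsuc d
  unusedColour with FP.any? (λ d → FP.all? (λ j → ¬? (w R j FP.≟ fsuc d)))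
  ... | yes p  = p
  ... | no ¬p = ⊥-elim (1+n≰n (≤-trans short (FP.injective⇒≤ {f = position} position-injective)))
    where
    hit : ∀ d → Σ (Fin (suc (l R))) λ j → w R j ≡ fsuc d
    hit d with FP.any? (λ j → w R j FP.≟ fsuc d)
    ... | yes p  = p
    ... | no ¬h = ⊥-elim (¬p (d , λ j e → ¬h (j , e)))
    hit≢0 : ∀ d → fzero ≢ proj₁ (hit d)
    hit≢0 d e with trans (sym R₀≡0) (trans (cong (w R) e) (proj₂ (hit d)))
    ... | ()
    position : Fin k → Fin (l R)
    position d = punchOut (hit≢0 d)
    position-injective : Injective _≡_ _≡_ position
    position-injective {a} {b} e = FP.suc-injective (trans (sym (proj₂ (hit a)))
      (trans (cong (w R) (FP.punchOut-injective (hit≢0 a) (hit≢0 b) e)) (proj₂ (hit b))))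

  d : Fin k
  d = proj₁ unusedColour

  P : Fin (suc (l R)) → Fin k
  P fzero    = d
  P (fsuc j) = punchOut (≢-sym (R≢0 (fsuc j) λ ()))

  fsuc-P : ∀ j → j ≢ fzero → fsuc (P j) ≡ w R j
  fsuc-P fzero    j≢0 = ⊥-elim (j≢0 refl)
  fsuc-P (fsuc j) _   = FP.punchIn-punchOut (≢-sym (R≢0 (fsuc j) λ ()))

  P-inj : Injective _≡_ _≡_ P
  P-inj {fzero}  {fzero}  e = refl
  P-inj {fzero}  {fsuc j} e = ⊥-elim (proj₂ unusedColour (fsuc j) (trans (sym (fsuc-P (fsuc j) λ ())) (cong fsuc (sym e))))
  P-inj {fsuc i} {fzero}  e = ⊥-elim (proj₂ unusedColour (fsuc i) (trans (sym (fsuc-P (fsuc i) λ ())) (cong fsuc e)))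
  P-inj {fsuc i} {fsuc j} e = w-inj R (trans (sym (fsuc-P (fsuc i) λ ())) (trans (cong fsuc e) (fsuc-P (fsuc j) λ ())))

  open ColourPattern k′ G crit mindeg (l R) P P-inj
  open Congruence (l R)
  open Walks (FP._≟_ {N})

  u₁ uₗ : Fin N
  u₁ = u (P (toFin 1))
  uₗ = u (P (toFin (l R)))

  toℕ-1 : toℕ (toFin 1) ≡ 1
  toℕ-1 = toℕ-toFin-small (s≤s (≤-trans (s≤s z≤n) (l≥2 R)))

  toℕ-l : toℕ (toFin (l R)) ≡ l R
  toℕ-l = toℕ-toFin-small ≤-refl

  u₁≢uₗ : u₁ ≢ uₗ
  u₁≢uₗ e = <⇒≢ (l≥2 R) (trans (sym toℕ-1) (trans (cong toℕ (P-inj (u-injective e))) toℕ-l))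

  path : Σ (List (Fin N)) λ ws → Walk Arc u₁ uₗ ws × Unique ws
  path = loopErase (proj₂ (arcWalk (toFin 1) (toFin (l R))))

  zs : List (Fin N)
  zs = proj₁ path

  u₁→uₗ : Walk Arc u₁ uₗ zs
  u₁→uₗ = proj₁ (proj₂ path)

  zs-colours : ∀ i → i < length zs → φ (nth zs i u₁) ≡ Pℕ (1 + i)
  zs-colours = walk-colours u₁→uₗ 1 (φ-u (P (toFin 1)))

  length-zs≋l : length zs ≋ l R
  length-zs≋l = toFin-injective (P-inj (trans (sym lastColour)
    (trans (cong φ (walk-last u₁ u₁→uₗ)) (φ-u (P (toFin (l R)))))))
    where
    sp : suc (pred (length zs)) ≡ length zs
    sp = suc-pred (length zs) {{>-nonZero (walk-nonempty u₁→uₗ)}}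
    lastColour : φ (nth zs (pred (length zs)) u₁) ≡ Pℕ (length zs)
    lastColour = trans (zs-colours _ (subst (pred (length zs) <_) sp ≤-refl)) (cong Pℕ sp)

  record Realisation : Set where
    field
      cycle     : Cycle G
      starts-v  : w cycle fzero ≡ v
      colours   : ∀ i → 0 < i → i < len cycle → φ (OnCycle.W cycle i) ≡ Pℕ i
      m∣len     : m ∣ len cycle

  realise : (xs : List (Fin N)) → Walk Arc u₁ uₗ xs → Unique xs → All (_≢ v) xs →
            (∀ i → i < length xs → φ (nth xs i u₁) ≡ Pℕ (1 + i)) → length xs ≋ l R → Realisation
  realise [] () _ _ _ _
  realise (_ ∷ []) walk _ _ _ _ = ⊥-elim (u₁≢uₗ (trans (sym (walk-head u₁ walk)) (walk-last u₁ walk)))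
  realise xs@(y₀ ∷ y₁ ∷ rest) walk uniq avoid-v cols len≋l = record
    { cycle    = Z
    ; starts-v = refl
    ; colours  = colours
    ; m∣len    = m%n≡0⇒n∣m (suc (length xs)) m (get (≋-trans (≡⇒≋ (+-comm 1 (length xs)))
                                                  (≋-trans (+-≋ len≋l (≋-refl {1})) l+1≋0))) }
    where
    Adj′ : Fin N → Fin N → Set
    Adj′ x y = Adj G x y ≡ true
    steps : ∀ i → suc i < length (v ∷ xs) → Adj′ (nth (v ∷ xs) i v) (nth (v ∷ xs) (suc i) v)
    steps zero    _       = subst (Adj′ v) (sym (walk-head y₀ walk)) (u-adj (P (toFin 1)))
    steps (suc i) (s≤s p) = subst₂ Adj′ (nth-irrelevant xs i y₀ v (≤-trans (n≤1+n _) p)) (nth-irrelevant xs (suc i) y₀ v p)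
                                   (proj₁ (walk-edge y₀ walk i p))
    closing : Adj′ (nth (v ∷ xs) (suc (suc (length rest))) v) v
    closing = subst (λ t → Adj′ t v) (sym (trans (nth-irrelevant xs (suc (length rest)) v y₀ ≤-refl) (walk-last y₀ walk)))
                    (trans (adj-sym G uₗ v) (u-adj (P (toFin (l R)))))
    Z : Cycle G
    Z = listCycle G Adj′ id v y₀ y₁ rest (All.map (_∘ sym) avoid-v ∷ uniq) steps closing
    colours : ∀ i → 0 < i → i < len Z → φ (OnCycle.W Z i) ≡ Pℕ i
    colours (suc i) _ lt = trans (cong (λ t → φ (nth (v ∷ xs) t v)) (Congruence.toℕ-toFin-small (l Z) lt))
      (trans (cong φ (nth-irrelevant xs i v y₀ (≤-pred lt))) (trans (cong φ (nth-irrelevant xs i y₀ u₁ (≤-pred lt))) (cols i (≤-pred lt))))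

  opaque
    realisation : Realisation
    realisation = realise zs u₁→uₗ (proj₂ (proj₂ path)) (walk-all (_≢ v) (proj₁ ∘ proj₂) (u-≢v (P (toFin (l R)))) u₁→uₗ)
                          zs-colours length-zs≋l

  open Realisation realisation public

  R≡colours : ∀ i → 0 < i → i < len cycle → ¬ (i % m ≡ 0) → OnCycle.W R i ≡ fsuc (φ (OnCycle.W cycle i))
  R≡colours i 0<i i<len i≢0 = trans (sym (fsuc-P (toFin i) (λ e → i≢0 (trans (sym (toℕ-toFin i)) (cong toℕ e)))))
                                     (cong fsuc (sym (colours i 0<i i<len)))

-- Cycles through a common vertex whose lengths divide L = suc Lp are determined by the
-- (Lp-periodic) sequence F they follow at positions that are not multiples of their length.
module DeterminedBySequence {H : Graph} (Lp : ℕ) (F : ℕ → Fin (n H))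
                            (F-periodic : ∀ i j → Congruence._≋_ Lp i j → F i ≡ F j) where
  private
    L : ℕ
    L = suc Lp
    module ML = Congruence Lp

    l*i+i≡i*m : ∀ l i → l * i + i ≡ i * suc l
    l*i+i≡i*m = solve-∀

  Follows : Cycle H → (ℕ → Fin (n H)) → Set
  Follows S F′ = ∀ i → 0 < i → i < L → ¬ (i % len S ≡ 0) → OnCycle.W S i ≡ F′ i

  module Following (S : Cycle H) (S∣L : len S ∣ L) (F′ : ℕ → Fin (n H)) (follows : Follows S F′) where
    open Congruence (l S)
    open OnCycle S using (W; W-cong)

    len≤L : len S ≤ L
    len≤L = ∣⇒≤ S∣L

    L≋0 : L ≋ 0
    L≋0 = mk (n∣m⇒m%n≡0 L (len S) S∣L)

    nonMultiple : ∀ j → 0 < j → j < len S → ¬ (j % len S ≡ 0)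
    nonMultiple j 0<j j<m e with trans (sym (m<n⇒m%n≡m j<m)) e
    ... | refl with 0<j
    ...   | ()

    follows-< : ∀ i → 0 < i → i ≤ l S → W i ≡ F′ i
    follows-< i 0<i i≤l = follows i 0<i (≤-trans (s≤s i≤l) len≤L) (nonMultiple i 0<i (s≤s i≤l))

    Lp≋l : Lp ≋ l S
    Lp≋l = +-cancelʳ-≋ {c = 1} (≋-trans (≡⇒≋ (+-comm Lp 1)) (≋-trans L≋0 (≋-sym l+1≋0)))

    follows-last : W (l S) ≡ F′ Lp
    follows-last = trans (W-cong (≋-sym Lp≋l))
      (follows Lp (≤-trans (s≤s z≤n) (≤-pred (≤-trans (s≤s (l≥2 S)) len≤L))) ≤-refl
               (λ e → nonMultiple (l S) (≤-trans (s≤s z≤n) (l≥2 S)) ≤-refl (trans (sym (get Lp≋l)) e)))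

    L∸i≋m∸i : ∀ i → i ≤ len S → i ≤ L → L ∸ i ≋ len S ∸ i
    L∸i≋m∸i i i≤m i≤L = +-cancelʳ-≋ {c = i}
      (≋-trans (≡⇒≋ (m∸n+n≡m i≤L)) (≋-trans L≋0 (≋-trans (≋-sym m≋0) (≡⇒≋ (sym (m∸n+n≡m i≤m))))))

    l*i≋m∸i : ∀ i → i ≤ len S → l S * i ≋ len S ∸ i
    l*i≋m∸i i i≤m = +-cancelʳ-≋ {c = i}
      (≋-trans (≡⇒≋ (l*i+i≡i*m (l S) i)) (≋-trans (*m≋0 i) (≋-trans (≋-sym m≋0) (≡⇒≋ (sym (m∸n+n≡m i≤m))))))

    follows-reflected : ∀ i → 0 < i → i ≤ l S → F′ (L ∸ i) ≡ W (len S ∸ i)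
    follows-reflected i 0<i i≤l = sym (trans (W-cong (≋-sym (L∸i≋m∸i i (≤-trans i≤l (n≤1+n _)) i≤L)))
                                            (follows (L ∸ i) (m<n⇒0<n∸m i<L) (∸-monoʳ-< 0<i i≤L) nonMult))
      where
      i≤L : i ≤ L
      i≤L = ≤-trans (≤-trans i≤l (n≤1+n _)) len≤L
      i<L : i < L
      i<L = ≤-trans (s≤s i≤l) len≤L
      nonMult : ¬ ((L ∸ i) % len S ≡ 0)
      nonMult e = nonMultiple (len S ∸ i) (m<n⇒0<n∸m (s≤s i≤l)) (∸-monoʳ-< 0<i (≤-trans i≤l (n≤1+n _)))
                              (trans (sym (get (L∸i≋m∸i i (≤-trans i≤l (n≤1+n _)) i≤L))) e)

  l*i≋L∸i : ∀ i → i ≤ L → Lp * i ML.≋ L ∸ i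
  l*i≋L∸i i i≤L = ML.+-cancelʳ-≋ {c = i}
    (ML.≋-trans (ML.≡⇒≋ (l*i+i≡i*m Lp i)) (ML.≋-trans (ML.*m≋0 i) (ML.≋-trans (ML.≋-sym ML.m≋0) (ML.≡⇒≋ (sym (m∸n+n≡m i≤L))))))

  module _ (T T′ : Cycle H) (sameStart : w T′ fzero ≡ w T fzero) (T∣L : len T ∣ L) (T′∣L : len T′ ∣ L) where
    private
      module T  = OnCycle T
      module T′ = OnCycle T′
      module MT  = Congruence (l T)
      module MT′ = Congruence (l T′)

      0<l : ∀ (S : Cycle H) → 0 < l S
      0<l S = ≤-trans (s≤s z≤n) (l≥2 S)

      i≤l : ∀ (S : Cycle H) (i : Fin (len S)) → toℕ i ≤ l S
      i≤l S i = ≤-pred (FP.toℕ<n i)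

    follows⇒≈C : Follows T F → Follows T′ F → T′ ≈C T
    follows⇒≈C fT fT′ = byLength (<-cmp (l T) (l T′))
      where
      module A  = Following T T∣L F fT
      module A′ = Following T′ T′∣L F fT′
      byLength : Tri (l T < l T′) (l T ≡ l T′) (l T′ < l T) → T′ ≈C T
      byLength (tri< lt _ _) = ⊥-elim (<⇒≢ lt (MT′.≋⇒≡ (≤-trans lt (n≤1+n _)) ≤-refl (T′.W-injective _ _
        (trans (A′.follows-< (l T) (0<l T) (<⇒≤ lt))
        (trans (sym (A.follows-< (l T) (0<l T) ≤-refl)) (trans A.follows-last (sym A′.follows-last)))))))
      byLength (tri> _ _ gt) = ⊥-elim (<⇒≢ gt (MT.≋⇒≡ (≤-trans gt (n≤1+n _)) ≤-refl (T.W-injective _ _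
        (trans (A.follows-< (l T′) (0<l T′) (<⇒≤ gt))
        (trans (sym (A′.follows-< (l T′) (0<l T′) ≤-refl)) (trans A′.follows-last (sym A.follows-last)))))))
      byLength (tri≈ _ eq _) = T.strided⇒≈C T′ (sym eq) 0 forward onT
        where
        onT : ∀ i → w T′ i ≡ T.W (0 + 1 * toℕ i)
        onT fzero = sameStart
        onT i@(fsuc _) = trans (T′.w≡W i) (trans (A′.follows-< (toℕ i) (s≤s z≤n) (i≤l T′ i))
          (trans (sym (A.follows-< (toℕ i) (s≤s z≤n) (subst (toℕ i ≤_) (sym eq) (i≤l T′ i))))
                 (cong T.W (sym (*-identityˡ (toℕ i))))))

    followsReversed⇒≈C : Follows T F → Follows T′ (λ i → F (Lp * i)) → T′ ≈C T
    followsReversed⇒≈C fT fT′ = byLength (<-cmp (l T) (l T′))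
      where
      module A  = Following T T∣L F fT
      module A′ = Following T′ T′∣L (λ i → F (Lp * i)) fT′
      reflected : ∀ i → 0 < i → i ≤ l T′ → i ≤ l T → T′.W i ≡ T.W (len T ∸ i)
      reflected i 0<i i≤l′ i≤l = trans (A′.follows-< i 0<i i≤l′)
        (trans (F-periodic _ _ (l*i≋L∸i i (≤-trans (≤-trans i≤l (n≤1+n _)) A.len≤L))) (A.follows-reflected i 0<i i≤l))
      last′ : T′.W (l T′) ≡ T.W 1
      last′ = trans A′.follows-last (trans (F-periodic _ _ ML.l*l≋1) (sym (A.follows-< 1 (s≤s z≤n) (0<l T))))
      byLength : Tri (l T < l T′) (l T ≡ l T′) (l T′ < l T) → T′ ≈C T
      byLength (tri< lt _ _) = ⊥-elim (<⇒≢ lt (MT′.≋⇒≡ (≤-trans lt (n≤1+n _)) ≤-refl (T′.W-injective _ _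
        (trans (reflected (l T) (0<l T) (<⇒≤ lt) ≤-refl) (trans (cong T.W (m+n∸n≡m 1 (l T))) (sym last′))))))
      byLength (tri> _ _ gt) = ⊥-elim (<⇒≢ gt l′≡l)
        where
        m∸l′≡1 : len T ∸ l T′ ≡ 1
        m∸l′≡1 = MT.≋⇒≡ (∸-monoʳ-< (0<l T′) (≤-trans (<⇒≤ gt) (n≤1+n _))) (s≤s (0<l T))
                        (T.W-injective _ _ (trans (sym (reflected (l T′) (0<l T′) ≤-refl (<⇒≤ gt))) last′))
        l′≡l : l T′ ≡ l T
        l′≡l = suc-injective (trans (cong (_+ l T′) (sym m∸l′≡1)) (m∸n+n≡m (≤-trans (<⇒≤ gt) (n≤1+n _))))
      byLength (tri≈ _ eq _) = T.strided⇒≈C T′ (sym eq) 0 backward onT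
        where
        onT : ∀ i → w T′ i ≡ T.W (0 + l T * toℕ i)
        onT fzero = trans sameStart (cong T.W (sym (*-zeroʳ (l T))))
        onT i@(fsuc _) = trans (T′.w≡W i)
          (trans (reflected (toℕ i) (s≤s z≤n) (i≤l T′ i) (subst (toℕ i ≤_) (sym eq) (i≤l T′ i)))
                 (T.W-cong (MT.≋-sym (A.l*i≋m∸i (toℕ i) (≤-trans (subst (toℕ i ≤_) (sym eq) (i≤l T′ i)) (n≤1+n _))))))

-- Canonical presentations of cycles of K_{k+1}

data FirstTrue {n : ℕ} (p : Fin n → Bool) : Set where
  found : (i : Fin n) → p i ≡ true → (∀ j → toℕ j < toℕ i → p j ≡ false) → FirstTrue p
  none  : (∀ j → p j ≡ false) → FirstTrue p

opaque
  firstTrue? : ∀ {n} (p : Fin n → Bool) → FirstTrue p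
  firstTrue? {zero}  p = none (λ ())
  firstTrue? {suc n} p with p fzero in p0
  ... | true  = found fzero p0 (λ j ())
  ... | false with firstTrue? (p ∘ fsuc)
  ...   | found i pi before = found (fsuc i) pi (λ { fzero _ → p0 ; (fsuc j) (s≤s j<i) → before j j<i })
  ...   | none ¬p          = none (λ { fzero → p0 ; (fsuc j) → ¬p j })

-- d is returned when p holds nowhere
firstTrue : ∀ {n} → (Fin n → Bool) → Fin n → Fin n
firstTrue p d with firstTrue? p
... | found i _ _ = i
... | none _      = d

firstTrue-true : ∀ {n} (p : Fin n → Bool) d i → p i ≡ true → p (firstTrue p d) ≡ true
firstTrue-true p d i pi with firstTrue? p
... | found j pj _ = pj
... | none ¬p with trans (sym (¬p i)) pi
...   | ()

firstTrue-least : ∀ {n} (p : Fin n → Bool) d i → p i ≡ true → ∀ j → toℕ j < toℕ (firstTrue p d) → p j ≡ false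
firstTrue-least p d i pi with firstTrue? p
... | found j pj before = before
... | none ¬p with trans (sym (¬p i)) pi
...   | ()

firstTrue-≡ : ∀ {n} (p : Fin n → Bool) d i → p i ≡ true → (∀ j → toℕ j < toℕ i → p j ≡ false) → firstTrue p d ≡ i
firstTrue-≡ p d i pi before with <-cmp (toℕ (firstTrue p d)) (toℕ i)
... | tri< lt _ _ with trans (sym (before _ lt)) (firstTrue-true p d i pi)
...   | ()
firstTrue-≡ p d i pi before | tri≈ _ eq _ = FP.toℕ-injective eq
firstTrue-≡ p d i pi before | tri> _ _ gt with trans (sym (firstTrue-least p d i pi i gt)) pi
...   | ()

does-true : ∀ {A : Set} (a? : Dec A) → does a? ≡ true → A
does-true (yes a) _ = a

does-false : ∀ {A : Set} (a? : Dec A) → does a? ≡ false → ¬ A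
does-false (no ¬a) _ = ¬a

∧≡true : ∀ {a b} → a ∧ b ≡ true → (a ≡ true) × (b ≡ true)
∧≡true {true} {true} _ = refl , refl

CEdge? : ∀ {H : Graph} (C : Cycle H) a b → Dec (CEdge C a b)
CEdge? C a b = FP.any? (λ i → ((a FP.≟ w C i) ×-dec (b FP.≟ w C (next i))) ⊎-dec ((b FP.≟ w C i) ×-dec (a FP.≟ w C (next i))))

-- A presentation of a cycle of K_{k+1} computed from its edge set alone, stored as a
-- Vec-matrix so that equal edge sets give propositionally equal inputs.
module Canonical (k′ : ℕ) where
  k : ℕ
  k = suc (suc (suc k′))

  V : Set
  V = Fin (suc k)

  Matrix : Set
  Matrix = Vec (Vec Bool (suc k)) (suc k)

  E : Matrix → V → V → Bool
  E M a b = Vec.lookup (Vec.lookup M a) b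

  opaque
    edgeMatrix : Cycle (K (suc k)) → Matrix
    edgeMatrix C = Vec.tabulate (λ a → Vec.tabulate (λ b → does (CEdge? C a b)))

    E-edgeMatrix : ∀ C a b → E (edgeMatrix C) a b ≡ does (CEdge? C a b)
    E-edgeMatrix C a b = trans (cong (λ row → Vec.lookup row b) (VecP.lookup∘tabulate (λ a → Vec.tabulate (λ b → does (CEdge? C a b))) a))
                               (VecP.lookup∘tabulate (λ b → does (CEdge? C a b)) b)

    edgeMatrix-cong : ∀ C D → C ≈C D → edgeMatrix C ≡ edgeMatrix D
    edgeMatrix-cong C D C≈D = VecP.tabulate-cong
      {f = λ a → Vec.tabulate (λ b → does (CEdge? C a b))} {g = λ a → Vec.tabulate (λ b → does (CEdge? D a b))}
      (λ a → VecP.tabulate-cong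
      {f = λ b → does (CEdge? C a b)} {g = λ b → does (CEdge? D a b)} (λ b → does-⇔ (C≈D a b) (CEdge? C a b) (CEdge? D a b)))

  triangle : CycleLe k (K (suc k))
  triangle = record { l = 2 ; l≥2 = s≤s (s≤s z≤n) ; w = tri ; w-inj = tri-inj ; w-adj = tri-adj } , s≤s (s≤s (s≤s z≤n))
    where
    tri : Fin 3 → V
    tri fzero               = fzero
    tri (fsuc fzero)        = fsuc fzero
    tri (fsuc (fsuc fzero)) = fsuc (fsuc fzero)
    tri-inj : Injective _≡_ _≡_ tri
    tri-inj {fzero}               {fzero}               _ = refl
    tri-inj {fsuc fzero}          {fsuc fzero}          _ = refl
    tri-inj {fsuc (fsuc fzero)}   {fsuc (fsuc fzero)}   _ = refl
    tri-inj {fzero}               {fsuc fzero}          ()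
    tri-inj {fzero}               {fsuc (fsuc fzero)}   ()
    tri-inj {fsuc fzero}          {fzero}               ()
    tri-inj {fsuc fzero}          {fsuc (fsuc fzero)}   ()
    tri-inj {fsuc (fsuc fzero)}   {fzero}               ()
    tri-inj {fsuc (fsuc fzero)}   {fsuc fzero}          ()
    tri-adj : ∀ i → Adj (K (suc k)) (tri i) (tri (next i)) ≡ true
    tri-adj fzero               = refl
    tri-adj (fsuc fzero)        = refl
    tri-adj (fsuc (fsuc fzero)) = refl

  -- Malformed matrices give the triangle, which never happens for edge matrices of cycles.
  module Trace (M : Matrix) where
    hasNeighbour : V → Bool
    hasNeighbour a = does (FP.any? (λ b → E M a b BP.≟ true))

    start : V
    start = firstTrue hasNeighbour fzero

    successor : V → V → V
    successor p c = firstTrue (λ b → E M c b ∧ not (does (b FP.≟ p))) c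

    pairs : ℕ → V × V
    pairs zero    = start , firstTrue (E M start) start
    pairs (suc j) = proj₂ (pairs j) , successor (proj₁ (pairs j)) (proj₂ (pairs j))

    s : ℕ → V
    s j = proj₁ (pairs j)

    returns : Fin (suc k) → Bool
    returns j = does (s (suc (toℕ j)) FP.≟ start)

    lT : ℕ
    lT = toℕ (firstTrue returns fzero)

    wT : Fin (suc lT) → V
    wT i = s (toℕ i)

    IsShortCycle : Set
    IsShortCycle = (2 ≤ lT) × (∀ i j → wT i ≡ wT j → i ≡ j) ×
                   (∀ i → Adj (K (suc k)) (wT i) (wT (next i)) ≡ true) × (suc lT ≤ k)

    opaque
      isShortCycle? : Dec IsShortCycle
      isShortCycle? = (2 ≤? lT) ×-dec (FP.all? (λ i → FP.all? (λ j → (wT i FP.≟ wT j) →-dec (i FP.≟ j))) ×-dec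
                      (FP.all? (λ i → Adj (K (suc k)) (wT i) (wT (next i)) BP.≟ true) ×-dec (suc lT ≤? k)))

    traced : Dec IsShortCycle → CycleLe k (K (suc k))
    traced (yes (2≤l , inj , adj , short)) = record { l = lT ; l≥2 = 2≤l ; w = wT ; w-inj = λ {i} {j} → inj i j ; w-adj = adj } , short
    traced (no _) = triangle

    trace : CycleLe k (K (suc k))
    trace = traced isShortCycle?

  canonical : Cycle (K (suc k)) → CycleLe k (K (suc k))
  canonical C = Trace.trace (edgeMatrix C)

  canonical-cong : ∀ C D → C ≈C D → canonical C ≡ canonical D
  canonical-cong C D C≈D = cong Trace.trace (edgeMatrix-cong C D C≈D)

module CanonicalCorrect (k′ : ℕ) (C : Cycle (K (suc (suc (suc (suc k′)))))) (short : len C ≤ suc (suc (suc k′))) where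
  open Canonical k′
  open Trace (edgeMatrix C)
  open OnCycle C
  open Congruence (l C)

  private
    M : Matrix
    M = edgeMatrix C

  E⇒CEdge : ∀ {a b} → E M a b ≡ true → CEdge C a b
  E⇒CEdge {a} {b} e = does-true (CEdge? C a b) (trans (sym (E-edgeMatrix C a b)) e)

  CEdge⇒E : ∀ {a b} → CEdge C a b → E M a b ≡ true
  CEdge⇒E {a} {b} e = trans (E-edgeMatrix C a b) (dec-true (CEdge? C a b) e)

  OnC : V → Set
  OnC x = Σ ℕ λ y → x ≡ W y

  CEdge-OnC : ∀ {a b} → CEdge C a b → OnC b
  CEdge-OnC (i , inj₁ (_ , q)) = toℕ i + 1 , trans q (w-next≡W i)
  CEdge-OnC (i , inj₂ (p , _)) = toℕ i , trans p (w≡W i)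

  neighbours-distinct : ∀ y → W (y + 1) ≢ W (y + l C)
  neighbours-distinct y e = <⇒≢ (l≥2 C) (≋⇒≡ (s≤s (≤-trans (s≤s z≤n) (l≥2 C))) ≤-refl (+-cancelˡ-≋ {c = y} (W-injective _ _ e)))

  hasNeighbour-W : ∀ y → hasNeighbour (W y) ≡ true
  hasNeighbour-W y = dec-true (FP.any? (λ b → E M (W y) b BP.≟ true)) (W (y + 1) , CEdge⇒E (edge-+1 y))

  abstract
    start-OnC : OnC start
    start-OnC with does-true (FP.any? (λ b → E M start b BP.≟ true)) (firstTrue-true hasNeighbour fzero (W 0) (hasNeighbour-W 0))
    ... | b , eb = CEdge-OnC (CEdge-sym C (E⇒CEdge eb))

  r : ℕ
  r = proj₁ start-OnC

  start≡ : start ≡ W r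
  start≡ = proj₂ start-OnC

  successor-edge : ∀ p c → OnC c → (E M c (successor p c) ≡ true) × (successor p c ≢ p)
  successor-edge p c (y , c≡) with ∧≡true (firstTrue-true candidate? c (proj₁ candidate) (proj₂ candidate))
    where
    candidate? : V → Bool
    candidate? b = E M c b ∧ not (does (b FP.≟ p))
    candidate : Σ V λ b → candidate? b ≡ true
    candidate with W (y + 1) FP.≟ p
    ... | no ≢p = W (y + 1) , subst (λ t → E M t (W (y + 1)) ∧ not (does (W (y + 1) FP.≟ p)) ≡ true) (sym c≡)
                    (subst (λ z → E M (W y) (W (y + 1)) ∧ not z ≡ true) (sym (dec-false (W (y + 1) FP.≟ p) ≢p))
                           (cong (_∧ true) (CEdge⇒E (edge-+1 y))))
    ... | yes ≡p = W (y + l C) , subst (λ t → E M t (W (y + l C)) ∧ not (does (W (y + l C) FP.≟ p)) ≡ true) (sym c≡)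
                    (subst (λ z → E M (W y) (W (y + l C)) ∧ not z ≡ true)
                           (sym (dec-false (W (y + l C) FP.≟ p) (λ e → neighbours-distinct y (trans ≡p (sym e)))))
                           (cong (_∧ true) (CEdge⇒E (edge-+L y))))
  ... | edge , notPrevious = edge , does-false (successor p c FP.≟ p) (trans (sym (BP.not-involutive _)) (cong not notPrevious))

  step-edge : ∀ j → OnC (s j) × CEdge C (s j) (s (suc j))
  step-edge zero = (r , start≡) ,
    E⇒CEdge (firstTrue-true (E M start) start (W (r + 1)) (subst (λ t → E M t (W (r + 1)) ≡ true) (sym start≡) (CEdge⇒E (edge-+1 r))))
  step-edge (suc j) = on , E⇒CEdge (proj₁ (successor-edge (s j) (s (suc j)) on))
    where on = CEdge-OnC (proj₂ (step-edge j))

  abstract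
    strided : Σ Direction λ d → ∀ j → s j ≡ W (r + stride d * j)
    strided = nonBacktracking⇒strided s r start≡ (λ j → proj₂ (step-edge j))
                (λ j → proj₂ (successor-edge (s j) (s (suc j)) (CEdge-OnC (proj₂ (step-edge j)))))

  d : Direction
  d = proj₁ strided

  s≡W : ∀ j → s j ≡ W (r + stride d * j)
  s≡W = proj₂ strided

  s-injective : ∀ {i j} → s i ≡ s j → r + stride d * i ≋ r + stride d * j
  s-injective {i} {j} e = W-injective _ _ (trans (sym (s≡W i)) (trans e (s≡W j)))

  lastIndex : Fin (suc k)
  lastIndex = fromℕ< {l C} (FP.injective⇒≤ (w-inj C))

  toℕ-lastIndex : toℕ lastIndex ≡ l C
  toℕ-lastIndex = FP.toℕ-fromℕ< (FP.injective⇒≤ (w-inj C))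

  returns-last : returns lastIndex ≡ true
  returns-last = dec-true (s (suc (toℕ lastIndex)) FP.≟ start) (trans (s≡W (suc (toℕ lastIndex))) (trans (W-cong back) (sym start≡)))
    where
    back : r + stride d * suc (toℕ lastIndex) ≋ r
    back = ≋-trans (+-≋ (≋-refl {r}) (*-≋ (≋-refl {stride d}) (≋-trans (≡⇒≋ (cong suc toℕ-lastIndex)) m≋0)))
                   (≡⇒≋ (trans (cong (r +_) (*-zeroʳ (stride d))) (+-identityʳ r)))

  returns-before : ∀ j → toℕ j < toℕ lastIndex → returns j ≡ false
  returns-before j lt = dec-false (s (suc (toℕ j)) FP.≟ start) λ e →
    1+n≢0 (≋⇒≡ (s≤s (subst (toℕ j <_) toℕ-lastIndex lt)) (s≤s z≤n)
      (stride-cancel d (≋-trans (+-cancelˡ-≋ {c = r}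
        (≋-trans (W-injective _ r (trans (sym (s≡W (suc (toℕ j)))) (trans e start≡))) (≡⇒≋ (sym (+-identityʳ r)))))
        (≡⇒≋ (sym (*-zeroʳ (stride d)))))))

  lT≡l : lT ≡ l C
  lT≡l = trans (cong toℕ (firstTrue-≡ returns fzero lastIndex returns-last returns-before)) toℕ-lastIndex

  isShortCycle : IsShortCycle
  isShortCycle = subst (2 ≤_) (sym lT≡l) (l≥2 C) , injective , adjacent , subst (λ t → suc t ≤ k) (sym lT≡l) short
    where
    i<m : ∀ (i : Fin (suc lT)) → toℕ i < suc (l C)
    i<m i = subst (λ t → toℕ i < suc t) lT≡l (FP.toℕ<n i)
    injective : ∀ i j → wT i ≡ wT j → i ≡ j
    injective i j e = FP.toℕ-injective (≋⇒≡ (i<m i) (i<m j) (stride-cancel d (+-cancelˡ-≋ {c = r} (s-injective e))))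
    CEdge⇒Adj : ∀ {a b} → CEdge C a b → Adj (K (suc k)) a b ≡ true
    CEdge⇒Adj (i , inj₁ (p , q)) = subst₂ (λ x y → Adj (K (suc k)) x y ≡ true) (sym p) (sym q) (w-adj C i)
    CEdge⇒Adj {a} {b} (i , inj₂ (p , q)) = trans (adj-sym (K (suc k)) a b) (subst₂ (λ x y → Adj (K (suc k)) x y ≡ true) (sym p) (sym q) (w-adj C i))
    wT-next : ∀ i → wT (next i) ≡ s (suc (toℕ i))
    wT-next i = trans (s≡W (toℕ (next i))) (trans (W-cong (+-≋ (≋-refl {r}) (*-≋ (≋-refl {stride d}) (toℕ-next≋-cast i lT≡l))))
                      (trans (cong (λ t → W (r + stride d * t)) (+-comm (toℕ i) 1)) (sym (s≡W (suc (toℕ i))))))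
    adjacent : ∀ i → Adj (K (suc k)) (wT i) (wT (next i)) ≡ true
    adjacent i = subst (λ t → Adj (K (suc k)) (wT i) t ≡ true) (sym (wT-next i)) (CEdge⇒Adj (proj₂ (step-edge (toℕ i))))

  module _ {A : CycleLe k (K (suc k)) → Set} (onTrace : ∀ c → A (traced (yes c))) where
    viaTrace : A (canonical C)
    viaTrace with isShortCycle?
    ... | yes c = onTrace c
    ... | no ¬c = ⊥-elim (¬c isShortCycle)

  canonical-≈C : proj₁ (canonical C) ≈C C
  canonical-≈C = viaTrace {A = λ D → proj₁ D ≈C C} (λ c → strided⇒≈C (proj₁ (traced (yes c))) lT≡l r d (λ i → s≡W (toℕ i)))

  canonical-len : l (proj₁ (canonical C)) ≡ l C
  canonical-len = viaTrace {A = λ D → l (proj₁ D) ≡ l C} (λ _ → lT≡l)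

  -- the least vertex carrying an edge is 0 as soon as 0 lies on C
  canonical-starts0 : (Σ (Fin (suc (l C))) λ i → w C i ≡ fzero) → w (proj₁ (canonical C)) fzero ≡ fzero
  canonical-starts0 (i , Ci≡0) = viaTrace {A = λ D → w (proj₁ D) fzero ≡ fzero} λ _ →
    firstTrue-≡ hasNeighbour fzero fzero (subst (λ t → hasNeighbour t ≡ true) (trans (sym (w≡W i)) Ci≡0) (hasNeighbour-W (toℕ i))) (λ j ())

module Injection (k′ : ℕ) (G : Graph) (crit : Critical (suc (suc (suc k′))) G)
                 (mindeg : MinDegree G (suc (suc (suc k′)))) where
  open CriticalVertex k′ G crit mindeg
  open Canonical k′ using (canonical; canonical-cong; triangle)

  KG : Graph
  KG = K (suc k)

  Position : Cycle KG → Set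
  Position R = (w R fzero ≡ fzero) ⊎ (∀ j → w R j ≢ fzero)

  position? : ∀ R → Dec (Position R)
  position? R = (w R fzero FP.≟ fzero) ⊎-dec FP.all? (λ j → ¬? (w R j FP.≟ fzero))

  -- the `no` branch is never taken on canonical presentations
  realise : (R : CycleLe k KG) → Dec (Position (proj₁ R)) → Cycle G
  realise (R , short) (yes (inj₁ R₀≡0))  = ThroughZero.cycle k′ G crit mindeg R R₀≡0 short
  realise (R , short) (yes (inj₂ avoids)) = AvoidingZero.cycle k′ G crit mindeg R avoids
  realise _           (no _)              = ThroughZero.cycle k′ G crit mindeg (proj₁ triangle) refl (proj₂ triangle)

  canonical-position : (C : CycleLe k KG) → Position (proj₁ (canonical (proj₁ C)))
  canonical-position (C , short) = byStart (w R fzero FP.≟ fzero)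
    where
    R = proj₁ (canonical C)
    onC : ∀ j → w R j ≡ fzero → Σ (Fin (len C)) λ i → w C i ≡ fzero
    onC j Rj≡0 with Equivalence.to (CanonicalCorrect.canonical-≈C k′ C short (w R j) (w R (next j))) (j , inj₁ (refl , refl))
    ... | i , inj₁ (p , _) = i , trans (sym p) Rj≡0
    ... | i , inj₂ (_ , q) = next i , trans (sym q) Rj≡0
    byStart : Dec (w R fzero ≡ fzero) → Position R
    byStart (yes R₀≡0) = inj₁ R₀≡0
    byStart (no R₀≢0)  = inj₂ λ j Rj≡0 → R₀≢0 (CanonicalCorrect.canonical-starts0 k′ C short (onC j Rj≡0))

  realise-divisible : ∀ R p → Position (proj₁ R) → len (proj₁ R) ∣ len (realise R p)
  realise-divisible (R , short) (yes (inj₁ R₀≡0))  _   = ThroughZero.m∣len k′ G crit mindeg R R₀≡0 short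
  realise-divisible (R , short) (yes (inj₂ avoids)) _   = AvoidingZero.m∣len k′ G crit mindeg R avoids
  realise-divisible (R , short) (no ¬pos)           pos = ⊥-elim (¬pos pos)

  through-injective : ∀ R R₀≡0 short R′ R′₀≡0 short′ →
    ThroughZero.cycle k′ G crit mindeg R R₀≡0 short ≈C ThroughZero.cycle k′ G crit mindeg R′ R′₀≡0 short′ → R ≈C R′
  through-injective R R₀≡0 short R′ R′₀≡0 short′ Z≈Z′ = ≈C-sym R′ R (byDirection sameCycle)
    where
    module T  = ThroughZero k′ G crit mindeg R R₀≡0 short
    module T′ = ThroughZero k′ G crit mindeg R′ R′₀≡0 short′
    Z  = T.cycle
    Z′ = T′.cycle
    F : ℕ → Fin (suc k)
    F i = fsuc (φ (OnCycle.W Z i))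
    open DeterminedBySequence {H = KG} (l Z) F (λ i j i≋j → cong (fsuc ∘ φ) (OnCycle.W-cong Z i≋j))
    -- both start at v, so Z′ is Z read forwards or backwards
    sameCycle : (l Z′ ≡ l Z) × (Σ Direction λ d → ∀ j → OnCycle.W Z′ j ≡ OnCycle.W Z (0 + OnCycle.stride Z d * j))
    sameCycle = ≈C-sameStart Z Z′ Z≈Z′ (trans T′.starts-v (sym T.starts-v))
    sameStart : w R′ fzero ≡ w R fzero
    sameStart = trans R′₀≡0 (sym R₀≡0)
    R′∣L : len R′ ∣ len Z
    R′∣L = subst (λ t → len R′ ∣ suc t) (proj₁ sameCycle) T′.m∣len
    byDirection : (l Z′ ≡ l Z) × (Σ Direction λ d → ∀ j → OnCycle.W Z′ j ≡ OnCycle.W Z (0 + OnCycle.stride Z d * j)) → R′ ≈C R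
    byDirection (l′≡l , forward , Z′≡Z) = follows⇒≈C R R′ sameStart T.m∣len R′∣L T.R≡colours
      λ i 0<i i<L i≢0 → trans (T′.R≡colours i 0<i (subst (λ t → i < suc t) (sym l′≡l) i<L) i≢0)
                              (cong (fsuc ∘ φ) (trans (Z′≡Z i) (cong (OnCycle.W Z) (*-identityˡ i))))
    byDirection (l′≡l , backward , Z′≡Z) = followsReversed⇒≈C R R′ sameStart T.m∣len R′∣L T.R≡colours
      λ i 0<i i<L i≢0 → trans (T′.R≡colours i 0<i (subst (λ t → i < suc t) (sym l′≡l) i<L) i≢0)
                              (cong (fsuc ∘ φ) (Z′≡Z i))

  avoiding-injective : ∀ R avoids R′ avoids′ →
    AvoidingZero.cycle k′ G crit mindeg R avoids ≈C AvoidingZero.cycle k′ G crit mindeg R′ avoids′ → R ≈C R′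
  avoiding-injective R avoids R′ avoids′ Z≈Z′ p q = mk⇔
    (λ e → Equivalence.from (A′.decode p q) (transport A.cycle A′.cycle Z≈Z′ (Equivalence.to (A.decode p q) e)))
    (λ e → Equivalence.from (A.decode p q) (transport A′.cycle A.cycle (≈C-sym A.cycle A′.cycle Z≈Z′) (Equivalence.to (A′.decode p q) e)))
    where
    module A  = AvoidingZero k′ G crit mindeg R avoids
    module A′ = AvoidingZero k′ G crit mindeg R′ avoids′
    transport : ∀ Z Z′ → Z ≈C Z′ → ColouredEdge G φ Z p q → ColouredEdge G φ Z′ p q
    transport _ _ Z≈Z′ (a , b , e , pa , pb) = a , b , Equivalence.to (Z≈Z′ a b) e , pa , pb

  -- only the first kind of realisation passes through v
  through≉avoiding : ∀ R R₀≡0 short R′ avoids′ →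
    ¬ (ThroughZero.cycle k′ G crit mindeg R R₀≡0 short ≈C AvoidingZero.cycle k′ G crit mindeg R′ avoids′)
  through≉avoiding R R₀≡0 short R′ avoids′ Z≈Z′
    with Equivalence.to (Z≈Z′ v (w T.cycle (next fzero))) (fzero , inj₁ (sym T.starts-v , refl))
    where module T = ThroughZero k′ G crit mindeg R R₀≡0 short
  ... | i , inj₁ (p , _) = proj₁ (proj₂ (AvoidingZero.arcs k′ G crit mindeg R′ avoids′ i)) (sym p)
  ... | i , inj₂ (_ , q) = proj₁ (proj₂ (proj₂ (AvoidingZero.arcs k′ G crit mindeg R′ avoids′ i))) (sym q)

  realise-injective : ∀ R R′ p p′ → Position (proj₁ R) → Position (proj₁ R′) →
                      realise R p ≈C realise R′ p′ → proj₁ R ≈C proj₁ R′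
  realise-injective (R , s) (R′ , s′) (yes (inj₁ z)) (yes (inj₁ z′)) _ _ e = through-injective R z s R′ z′ s′ e
  realise-injective (R , s) (R′ , s′) (yes (inj₁ z)) (yes (inj₂ a′)) _ _ e = ⊥-elim (through≉avoiding R z s R′ a′ e)
  realise-injective (R , s) (R′ , s′) (yes (inj₂ a)) (yes (inj₁ z′)) _ _ e = ⊥-elim (through≉avoiding R′ z′ s′ R a (≈C-sym (AvoidingZero.cycle k′ G crit mindeg R a) (ThroughZero.cycle k′ G crit mindeg R′ z′ s′) e))
  realise-injective (R , s) (R′ , s′) (yes (inj₂ a)) (yes (inj₂ a′)) _ _ e = avoiding-injective R a R′ a′ e
  realise-injective _ _ (no ¬pos) _  pos _   _ = ⊥-elim (¬pos pos)
  realise-injective _ _ (yes _) (no ¬pos′) _ pos′ _ = ⊥-elim (¬pos′ pos′)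

  f : CycleLe k KG → Cycle G
  f C = realise R (position? (proj₁ R))
    where R = canonical (proj₁ C)

  f-cong : ∀ C D → proj₁ C ≈C proj₁ D → f C ≈C f D
  f-cong C D C≈D = subst (λ R → f C ≈C realise R (position? (proj₁ R))) (canonical-cong (proj₁ C) (proj₁ D) C≈D) (≈C-refl (f C))

  f-injective : ∀ C D → f C ≈C f D → proj₁ C ≈C proj₁ D
  f-injective C D fC≈fD = ≈C-trans (proj₁ C) R (proj₁ D) (≈C-sym R (proj₁ C) (CanonicalCorrect.canonical-≈C k′ (proj₁ C) (proj₂ C)))
    (≈C-trans R R′ (proj₁ D) (realise-injective (canonical (proj₁ C)) (canonical (proj₁ D)) (position? R) (position? R′)
                                            (canonical-position C) (canonical-position D) fC≈fD)
              (CanonicalCorrect.canonical-≈C k′ (proj₁ D) (proj₂ D)))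
    where
    R  = proj₁ (canonical (proj₁ C))
    R′ = proj₁ (canonical (proj₁ D))

  f-divisible : ∀ C → len (proj₁ C) ∣ len (f C)
  f-divisible C = subst (λ t → suc t ∣ len (f C)) (CanonicalCorrect.canonical-len k′ (proj₁ C) (proj₂ C))
                        (realise-divisible (canonical (proj₁ C)) (position? (proj₁ (canonical (proj₁ C)))) (canonical-position C))

theorem5 : (k : ℕ) → 3 ≤ k → (G : Graph) → Critical k G → MinDegree G k →
    Σ (CycleLe k (K (suc k)) → Cycle G) λ f →
    (∀ C D → proj₁ C ≈C proj₁ D → f C ≈C f D)
    × (∀ C D → f C ≈C f D → proj₁ C ≈C proj₁ D)
    × (∀ C → len (proj₁ C) ∣ len (f C))
theorem5 (suc (suc (suc k′))) (s≤s (s≤s (s≤s z≤n))) G crit mindeg = f , f-cong , f-injective , f-divisible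
  where open Injection k′ G crit mindeg
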